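{- For each $d\in\{2,3,4,5,6,9,11,13\}$, there exists a $d$-regular bipartite graph $G=(X,Y)$ satisfying the double Hall property with $|X|=|Y|=n=\binom d2+1$. Furthermore, for infinitely many values of $n$, there exists a $d$-regular bipartite graph $G=(X,Y)$ with $|X|=|Y|=n$ satisfying the double Hall property with $d=n^{\alpha}$, where $\alpha=\log_{79}13\approx 0.587$.
   Context: All graphs are finite and simple. A graph is $d$-regular if every vertex has degree exactly $d$. For a vertex set $S$, $\Lambda^2(S)$ denotes the set of vertices adjacent to at least two vertices of $S$. A bipartite graph $G=(X,Y)$ with $|X|\ge 2$ satisfies the double Hall property if $|\Lambda^2(S)|\ge |S|$ for every $S\subseteq X$ with $|S|\ge 2$. -}

module Defs where

open import Data.Bool using (Bool)
open import Data.Nat using (ℕ; _≤_; _≤ᵇ_; _^_)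
open import Data.Fin using (Fin)
open import Data.Fin.Subset using (Subset; ∣_∣; _∩_)
open import Data.Vec using (tabulate)
open import Data.Product using (_×_)
open import Function.Bundles using (_⇔_)
open import Relation.Binary.PropositionalEquality using (_≡_)

-- A (finite, simple) bipartite graph G = (X , Y) with |X| = |Y| = n :
-- X = Fin n, Y = Fin n, and  adj x y = true  iff x ∈ X is adjacent to y ∈ Y.
BipGraph : ℕ → Set
BipGraph n = Fin n → Fin n → Bool

nbrX : ∀ {n} → BipGraph n → Fin n → Subset n
nbrX G x = tabulate (G x)

nbrY : ∀ {n} → BipGraph n → Fin n → Subset n
nbrY G y = tabulate (λ x → G x y)

Regular : ∀ {n} → ℕ → BipGraph n → Set
Regular {n} d G = (∀ (x : Fin n) → ∣ nbrX G x ∣ ≡ d) × (∀ (y : Fin n) → ∣ nbrY G y ∣ ≡ d)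

Λ² : ∀ {n} → BipGraph n → Subset n → Subset n
Λ² G S = tabulate (λ y → 2 ≤ᵇ ∣ S ∩ nbrY G y ∣)

-- double Hall property (with the standing requirement |X| ≥ 2)
DoubleHall : ∀ {n} → BipGraph n → Set
DoubleHall {n} G = (2 ≤ n) × (∀ (S : Subset n) → 2 ≤ ∣ S ∣ → ∣ S ∣ ≤ ∣ Λ² G S ∣)

-- d = n ^ α with α = log₇₉ 13, for n ≥ 1, d ≥ 1, stated without reals:
-- d = n^α  ⇔  log₁₃ d = log₇₉ n  (two nonnegative reals), which holds iff they
-- have the same Dedekind cut on nonnegative rationals b / a (a ≥ 1), i.e.
--   log₁₃ d ≤ b/a ⇔ log₇₉ n ≤ b/a,  i.e.  d ^ a ≤ 13 ^ b ⇔ n ^ a ≤ 79 ^ b.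
IsPowAlpha : ℕ → ℕ → Set
IsPowAlpha n d = (1 ≤ n) × (1 ≤ d) ×
  (∀ (a b : ℕ) → 1 ≤ a → ((d ^ a ≤ 13 ^ b) ⇔ (n ^ a ≤ 79 ^ b)))

{-# OPTIONS --safe #-}
module Submission where

-- The d-regular examples are incidence graphs of biplanes (symmetric designs in which any two
-- points lie on exactly two blocks and any two blocks meet in exactly two points); biplanes with
-- blocks of size d, on C(d,2) + 1 points, are known for the listed d and are given by block tables.
-- Given S with |Λ²(S)| < |S|, either some block of Λ²(S) contains all of S, and double counting
-- around one point of S forces |S| ≤ |Λ²(S)|, or every block of Λ²(S) misses a point of S; then
-- the bipartite graph of non-incidences between S and Λ²(S) has, along each edge,
-- |S|·deg x < |Λ²(S)|·deg y, which the edge weights 1/(|S| deg x) and 1/(|Λ²(S)| deg y) rule out.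
-- The infinite family consists of the tensor powers of the biplane on 79 points: for regular G
-- and double-Hall G, H the product G ⊗ H is again double-Hall, by applying the property of H
-- slice by slice and summing along the edges of the regular factor.

import Algebra.Properties.CommutativeSemigroup as CommutativeSemigroupProperties
open import Data.Bool using (Bool; true; false; T; not; _∧_; _∨_; if_then_else_)
open import Data.Bool.ListAction using (all)
open import Data.Bool.Properties using (∧-assoc; ∧-comm; ∧-zeroʳ; ∧-identityʳ)
open import Data.Empty using (⊥-elim)
open import Data.Fin using (Fin; zero; suc; toℕ; combine; remQuot; _↑ˡ_; _↑ʳ_)
open import Data.Fin.Properties using (_≟_; remQuot-combine; any?)
open import Data.Fin.Subset using (Subset; ∣_∣; _∩_)
open import Data.List using (List; []; _∷_; length; map)
open import Data.List.Membership.Propositional using (_∈_)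
open import Data.List.Relation.Unary.Any using (here; there)
open import Data.Nat hiding (_≟_)
open import Data.Nat.Combinatorics using (_C_)
open import Data.Nat.Divisibility using (_∣_; ∣-trans; m∣m*n; n∣m*n)
open import Data.Nat.Properties hiding (_≟_)
open import Data.Nat.Tactic.RingSolver using (solve-∀)
open import Data.Product using (_×_; _,_; proj₁; proj₂; Σ; ∃-syntax)
open import Data.Sum using (_⊎_; inj₁; inj₂)
open import Data.Unit using (tt)
open import Data.Vec using (Vec; _∷_; []; tabulate; lookup)
open import Data.Vec.Properties using (lookup∘tabulate; lookup-zipWith)
open import Function using (_∘_; _⇔_; mk⇔)
import Function.Properties.Equivalence as ⇔
open import Relation.Binary.PropositionalEquality
open import Relation.Nullary using (¬_; yes; no; does)
open import Relation.Nullary.Decidable using (T?)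

open import Defs

open import Algebra.Properties.Semiring.Sum +-*-semiring
  using (sum; sum-syntax; sum-cong-≗; sum-replicate-zero; ∑-comm; ∑-distrib-+; *-distribˡ-sum)

+-exchange : ∀ a b c → a + (b + c) ≡ b + (a + c)
+-exchange = CommutativeSemigroupProperties.x∙yz≈y∙xz +-commutativeSemigroup

*-exchange : ∀ a b c → a * (b * c) ≡ b * (a * c)
*-exchange = CommutativeSemigroupProperties.x∙yz≈y∙xz *-commutativeSemigroup

∧-intro : ∀ {a b} → T a → T b → T (a ∧ b)
∧-intro {true} _ t = t

∧-elim : ∀ a {b} → T (a ∧ b) → T a × T b
∧-elim true t = tt , t

not-intro : ∀ {b} → ¬ T b → T (not b)
not-intro {true}  ¬b = ¬b tt
not-intro {false} _  = tt

not-elim : ∀ b → T (not b) → ¬ T b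
not-elim true () _

𝟙 : Bool → ℕ
𝟙 true  = 1
𝟙 false = 0

𝟙-T : ∀ {b} → T b → 𝟙 b ≡ 1
𝟙-T {true} _ = refl

𝟙-mono : ∀ {a b} → (T a → T b) → 𝟙 a ≤ 𝟙 b
𝟙-mono {false}        _   = z≤n
𝟙-mono {true} {true}  _   = ≤-refl
𝟙-mono {true} {false} a⇒b = ⊥-elim (a⇒b tt)

𝟙[0<]≤ : ∀ k → 𝟙 (0 <ᵇ k) ≤ k
𝟙[0<]≤ zero    = z≤n
𝟙[0<]≤ (suc k) = s≤s z≤n

sum-mono-≤ : ∀ {n} {f g : Fin n → ℕ} → (∀ i → f i ≤ g i) → sum f ≤ sum g
sum-mono-≤ {zero}  f≤g = z≤n
sum-mono-≤ {suc n} f≤g = +-mono-≤ (f≤g zero) (sum-mono-≤ (f≤g ∘ suc))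

sum-mono-< : ∀ {n} {f g : Fin n → ℕ} → (∀ i → f i ≤ g i) → ∀ i → f i < g i → sum f < sum g
sum-mono-< f≤g zero    fi<gi = +-mono-<-≤ fi<gi (sum-mono-≤ (f≤g ∘ suc))
sum-mono-< f≤g (suc i) fi<gi = +-mono-≤-< (f≤g zero) (sum-mono-< (f≤g ∘ suc) i fi<gi)

sum-↑ : ∀ {m n} (f : Fin (m + n) → ℕ) → sum f ≡ ∑[ i < m ] f (i ↑ˡ n) + ∑[ j < n ] f (m ↑ʳ j)
sum-↑ {zero}      f = refl
sum-↑ {suc m} {n} f = trans (cong (f zero +_) (sum-↑ {m} {n} (f ∘ suc))) (sym (+-assoc (f zero) _ _))

sum-combine : ∀ {m n} (f : Fin (m * n) → ℕ) → sum f ≡ ∑[ i < m ] ∑[ j < n ] f (combine i j)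
sum-combine {zero}      f = refl
sum-combine {suc m} {n} f =
  trans (sum-↑ {n} {m * n} f) (cong (∑[ j < n ] f (j ↑ˡ m * n) +_) (sum-combine {m} {n} (f ∘ (n ↑ʳ_))))

∏ : ∀ {n} → (Fin n → ℕ) → ℕ
∏ {zero}  f = 1
∏ {suc n} f = f zero * ∏ (f ∘ suc)

∣∏ : ∀ {n} (f : Fin n → ℕ) i → f i ∣ ∏ f
∣∏ f zero    = m∣m*n _
∣∏ f (suc i) = ∣-trans (∣∏ (f ∘ suc) i) (n∣m*n (f zero))

∏-pos : ∀ {n} {f : Fin n → ℕ} → (∀ i → 0 < f i) → 0 < ∏ f
∏-pos {zero}  _   = z<s
∏-pos {suc n} pos = *-mono-≤ (pos zero) (∏-pos (pos ∘ suc))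

_-_ : ∀ {n} → (Fin n → Bool) → Fin n → Fin n → Bool
(P - x) i = not (does (x ≟ i)) ∧ P i

-⁺ : ∀ {n} {P : Fin n → Bool} {x i} → x ≢ i → T (P i) → T ((P - x) i)
-⁺ {x = x} {i} x≢i Pi with x ≟ i
... | yes x≡i = x≢i x≡i
... | no  _   = Pi

-⁻ : ∀ {n} {P : Fin n → Bool} {x i} → T ((P - x) i) → x ≢ i × T (P i)
-⁻ {x = x} {i} h with x ≟ i
... | no x≢i = x≢i , h

-- Opaque, so that unifying count P (or ∑∈ P f) with a given term determines P (and f).
opaque
  count : ∀ {n} → (Fin n → Bool) → ℕ
  count {n} P = ∑[ i < n ] 𝟙 (P i)

  ∑∈ : ∀ {n} → (Fin n → Bool) → (Fin n → ℕ) → ℕ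
  ∑∈ {n} P f = ∑[ i < n ] (𝟙 (P i) * f i)

  syntax ∑∈ P (λ i → f) = ∑[ i ∈ P ] f

  count≡sum : ∀ {n} (P : Fin n → Bool) → count P ≡ ∑[ i < n ] 𝟙 (P i)
  count≡sum P = refl

  count-suc : ∀ {n} (P : Fin (suc n) → Bool) → count P ≡ 𝟙 (P zero) + count (P ∘ suc)
  count-suc P = refl

  count-cong : ∀ {n} {P Q : Fin n → Bool} → (∀ i → P i ≡ Q i) → count P ≡ count Q
  count-cong P≡Q = sum-cong-≗ λ i → cong 𝟙 (P≡Q i)

  count-mono : ∀ {n} {P Q : Fin n → Bool} → (∀ i → T (P i) → T (Q i)) → count P ≤ count Q
  count-mono P⇒Q = sum-mono-≤ λ i → 𝟙-mono (P⇒Q i)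

  count-none : ∀ {n} {P : Fin n → Bool} → (∀ i → ¬ T (P i)) → count P ≡ 0
  count-none {n} {P} ¬P = trans (sum-cong-≗ λ i → cong 𝟙 (false! (P i) (¬P i))) (sum-replicate-zero n)
    where
    false! : ∀ b → ¬ T b → b ≡ false
    false! true  ¬b = ⊥-elim (¬b tt)
    false! false _  = refl

  count-split : ∀ {n} (P Q : Fin n → Bool) →
                count P ≡ count (λ i → P i ∧ Q i) + count (λ i → P i ∧ not (Q i))
  count-split P Q =
    trans (sum-cong-≗ λ i → split (P i) (Q i))
          (∑-distrib-+ (λ i → 𝟙 (P i ∧ Q i)) (λ i → 𝟙 (P i ∧ not (Q i))))
    where
    split : ∀ a b → 𝟙 a ≡ 𝟙 (a ∧ b) + 𝟙 (a ∧ not b)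
    split true  true  = refl
    split true  false = refl
    split false _     = refl

  count-combine : ∀ {m n} (P : Fin (m * n) → Bool) → count P ≡ ∑[ i < m ] count (λ j → P (combine i j))
  count-combine {m} {n} P = sum-combine {m} {n} (𝟙 ∘ P)

  count≡∑∈ : ∀ {n} (P : Fin n → Bool) → count P ≡ ∑[ i ∈ P ] 1
  count≡∑∈ P = sum-cong-≗ λ i → sym (*-identityʳ (𝟙 (P i)))

  count-∧≡∑∈ : ∀ {n} (P Q : Fin n → Bool) → count (λ i → P i ∧ Q i) ≡ ∑[ i ∈ P ] 𝟙 (Q i)
  count-∧≡∑∈ P Q = sum-cong-≗ λ i → 𝟙-∧ (P i) (Q i)
    where
    𝟙-∧ : ∀ a b → 𝟙 (a ∧ b) ≡ 𝟙 a * 𝟙 b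
    𝟙-∧ true  b = sym (+-identityʳ (𝟙 b))
    𝟙-∧ false b = refl

  sum-count-∧ : ∀ {m n} (P : Fin m → Bool) (Q : Fin m → Fin n → Bool) →
                ∑[ i < m ] count (λ j → P i ∧ Q i j) ≡ ∑[ i ∈ P ] count (Q i)
  sum-count-∧ {n = n} P Q = sum-cong-≗ λ i → guard (P i)
    where
    guard : ∀ a {i} → count (λ j → a ∧ Q i j) ≡ 𝟙 a * count (Q i)
    guard true  {i} = sym (+-identityʳ (count (Q i)))
    guard false     = sum-replicate-zero n

  ∑∈-cong : ∀ {n} (P : Fin n → Bool) {f g : Fin n → ℕ} →
            (∀ i → T (P i) → f i ≡ g i) → ∑∈ P f ≡ ∑∈ P g
  ∑∈-cong P f≡g = sum-cong-≗ λ i → guard (P i) (f≡g i)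
    where
    guard : ∀ b {u v} → (T b → u ≡ v) → 𝟙 b * u ≡ 𝟙 b * v
    guard true  u≡v = cong (1 *_) (u≡v tt)
    guard false _   = refl

  ∑∈-mono : ∀ {n} (P : Fin n → Bool) {f g : Fin n → ℕ} →
            (∀ i → T (P i) → f i ≤ g i) → ∑∈ P f ≤ ∑∈ P g
  ∑∈-mono P f≤g = sum-mono-≤ λ i → guard (P i) (f≤g i)
    where
    guard : ∀ b {u v} → (T b → u ≤ v) → 𝟙 b * u ≤ 𝟙 b * v
    guard true  u≤v = *-monoʳ-≤ 1 (u≤v tt)
    guard false _   = z≤n

  ∑∈-mono-< : ∀ {n} (P : Fin n → Bool) {f g : Fin n → ℕ} → (∀ i → T (P i) → f i ≤ g i) →
              ∀ {i} → T (P i) → f i < g i → ∑∈ P f < ∑∈ P g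
  ∑∈-mono-< P {f} {g} f≤g {i} Pi fi<gi = sum-mono-< (λ j → guard (P j) (f≤g j)) i
    (subst (λ k → k * f i < k * g i) (sym (𝟙-T Pi)) (*-monoʳ-< 1 fi<gi))
    where
    guard : ∀ b {u v} → (T b → u ≤ v) → 𝟙 b * u ≤ 𝟙 b * v
    guard true  u≤v = *-monoʳ-≤ 1 (u≤v tt)
    guard false _   = z≤n

  ∑∈-const : ∀ {n} (P : Fin n → Bool) c → ∑[ i ∈ P ] c ≡ c * count P
  ∑∈-const P c = trans (sum-cong-≗ λ i → *-comm (𝟙 (P i)) c) (sym (*-distribˡ-sum c (𝟙 ∘ P)))

  ∑∈-*ˡ : ∀ {n} (P : Fin n → Bool) c (f : Fin n → ℕ) → c * ∑∈ P f ≡ ∑[ i ∈ P ] (c * f i)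
  ∑∈-*ˡ P c f =
    trans (*-distribˡ-sum c (λ i → 𝟙 (P i) * f i)) (sum-cong-≗ λ i → *-exchange c (𝟙 (P i)) (f i))

  ∑∈-distrib-+ : ∀ {n} (P : Fin n → Bool) (f g : Fin n → ℕ) →
                 ∑[ i ∈ P ] (f i + g i) ≡ ∑∈ P f + ∑∈ P g
  ∑∈-distrib-+ P f g =
    trans (sum-cong-≗ λ i → *-distribˡ-+ (𝟙 (P i)) (f i) (g i))
          (∑-distrib-+ (λ i → 𝟙 (P i) * f i) (λ i → 𝟙 (P i) * g i))

  ≤-∑∈ : ∀ {n} (P : Fin n → Bool) (f : Fin n → ℕ) {i} → T (P i) → f i ≤ ∑∈ P f
  ≤-∑∈ P f {zero}  P0 rewrite 𝟙-T P0 = ≤-trans (≤-reflexive (sym (*-identityˡ (f zero)))) (m≤m+n _ _)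
  ≤-∑∈ P f {suc i} Pi = ≤-trans (≤-∑∈ (P ∘ suc) (f ∘ suc) Pi) (m≤n+m _ _)

  ∑∈-remove : ∀ {n} (P : Fin n → Bool) (f : Fin n → ℕ) {x} → T (P x) →
              ∑∈ P f ≡ f x + ∑∈ (P - x) f
  ∑∈-remove P f {zero} P0 rewrite 𝟙-T P0 = cong (_+ ∑∈ (P ∘ suc) (f ∘ suc)) (*-identityˡ (f zero))
  ∑∈-remove P f {suc x} Px =
    trans (cong (𝟙 (P zero) * f zero +_) (∑∈-remove (P ∘ suc) (f ∘ suc) Px))
          (+-exchange (𝟙 (P zero) * f zero) (f (suc x)) (∑∈ ((P ∘ suc) - x) (f ∘ suc)))

  ∑∈-swap : ∀ {m n} (R : Fin m → Fin n → Bool) (w : Fin m → Fin n → ℕ) →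
            ∑[ i < m ] ∑[ j ∈ R i ] w i j ≡ ∑[ j < n ] ∑[ i ∈ (λ i → R i j) ] w i j
  ∑∈-swap R w = ∑-comm (λ i j → 𝟙 (R i j) * w i j)

  ∑∈-comm : ∀ {m n} (P : Fin m → Bool) (Q : Fin n → Bool) (R : Fin m → Fin n → Bool)
            (w : Fin m → Fin n → ℕ) →
            ∑[ i ∈ P ] ∑[ j ∈ (λ j → Q j ∧ R i j) ] w i j ≡
            ∑[ j ∈ Q ] ∑[ i ∈ (λ i → P i ∧ R i j) ] w i j
  ∑∈-comm {m} {n} P Q R w = begin
    ∑[ i < m ] (𝟙 (P i) * ∑[ j < n ] (𝟙 (Q j ∧ R i j) * w i j))
      ≡⟨ sum-cong-≗ (λ i → *-distribˡ-sum (𝟙 (P i)) λ j → 𝟙 (Q j ∧ R i j) * w i j) ⟩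
    ∑[ i < m ] ∑[ j < n ] (𝟙 (P i) * (𝟙 (Q j ∧ R i j) * w i j))
      ≡⟨ sum-cong-≗ (λ i → sum-cong-≗ λ j → swap (P i) (Q j) (R i j)) ⟩
    ∑[ i < m ] ∑[ j < n ] (𝟙 (Q j) * (𝟙 (P i ∧ R i j) * w i j))
      ≡⟨ ∑-comm (λ i j → 𝟙 (Q j) * (𝟙 (P i ∧ R i j) * w i j)) ⟩
    ∑[ j < n ] ∑[ i < m ] (𝟙 (Q j) * (𝟙 (P i ∧ R i j) * w i j))
      ≡⟨ sum-cong-≗ (λ j → *-distribˡ-sum (𝟙 (Q j)) λ i → 𝟙 (P i ∧ R i j) * w i j) ⟨
    ∑[ j < n ] (𝟙 (Q j) * ∑[ i < m ] (𝟙 (P i ∧ R i j) * w i j))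
      ∎
    where
    open ≡-Reasoning
    swap : ∀ a b c {k} → 𝟙 a * (𝟙 (b ∧ c) * k) ≡ 𝟙 b * (𝟙 (a ∧ c) * k)
    swap true  true  c = refl
    swap true  false c = refl
    swap false true  c = refl
    swap false false c = refl

  ∣∣≡count : ∀ {n} (p : Subset n) → ∣ p ∣ ≡ count (lookup p)
  ∣∣≡count []          = refl
  ∣∣≡count (true  ∷ p) = cong suc (∣∣≡count p)
  ∣∣≡count (false ∷ p) = ∣∣≡count p

count-remove : ∀ {n} (P : Fin n → Bool) {x} → T (P x) → count P ≡ suc (count (P - x))
count-remove P {x} Px = begin
  count P                ≡⟨ count≡∑∈ P ⟩
  ∑[ i ∈ P ] 1           ≡⟨ ∑∈-remove P (λ _ → 1) Px ⟩
  suc (∑[ i ∈ P - x ] 1) ≡⟨ cong suc (count≡∑∈ (P - x)) ⟨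
  suc (count (P - x))    ∎
  where open ≡-Reasoning

count-pos : ∀ {n} (P : Fin n → Bool) {i} → T (P i) → 0 < count P
count-pos P Pi = subst (0 <_) (sym (count-remove P Pi)) z<s

count-≥2 : ∀ {n} (P : Fin n → Bool) {i j} → i ≢ j → T (P i) → T (P j) → 2 ≤ count P
count-≥2 P {i} i≢j Pi Pj =
  subst (2 ≤_) (sym (count-remove P Pi)) (s≤s (count-pos (P - i) (-⁺ {P = P} i≢j Pj)))

𝟙≤count : ∀ {n} (P : Fin n → Bool) i → 𝟙 (P i) ≤ count P
𝟙≤count P i with P i in eq
... | true  = count-pos P (subst T (sym eq) tt)
... | false = z≤n

count-witness : ∀ {n} (P : Fin n → Bool) → 0 < count P → ∃[ i ] T (P i)
count-witness {zero}  P pos = ⊥-elim (<-irrefl (sym (count-none {P = P} λ ())) pos)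
count-witness {suc n} P pos with P zero in eq
... | true  = zero , subst T (sym eq) tt
... | false = let i , Pi = count-witness (P ∘ suc) (subst (0 <_) count-P≡ pos) in suc i , Pi
  where
  count-P≡ : count P ≡ count (P ∘ suc)
  count-P≡ = trans (count-suc P) (cong (λ b → 𝟙 b + count (P ∘ suc)) eq)

count-two : ∀ {n} (P : Fin n → Bool) → 2 ≤ count P → ∃[ i ] ∃[ j ] (i ≢ j × T (P i) × T (P j))
count-two P 2≤P =
  let i , Pi     = count-witness P (≤-trans (s≤s z≤n) 2≤P)
      j , h      = count-witness (P - i) (≤-pred (subst (2 ≤_) (count-remove P Pi) 2≤P))
      i≢j , Pj   = -⁻ {P = P} h
  in i , j , i≢j , Pi , Pj

count-∧-absorbˡ : ∀ {n} {P Q : Fin n → Bool} → (∀ i → T (P i) → T (Q i)) →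
                  count (λ i → P i ∧ Q i) ≡ count P
count-∧-absorbˡ {P = P} {Q} P⇒Q = count-cong λ i → absorb (P i) (Q i) (P⇒Q i)
  where
  absorb : ∀ a b → (T a → T b) → a ∧ b ≡ a
  absorb true  true  _   = refl
  absorb true  false a⇒b = ⊥-elim (a⇒b tt)
  absorb false _     _   = refl

count-∧-absorbʳ : ∀ {n} {P Q : Fin n → Bool} → (∀ i → T (Q i) → T (P i)) →
                  count (λ i → P i ∧ Q i) ≡ count Q
count-∧-absorbʳ {P = P} {Q} Q⇒P = count-cong λ i → absorb (P i) (Q i) (Q⇒P i)
  where
  absorb : ∀ a b → (T b → T a) → a ∧ b ≡ b
  absorb true  _     _   = refl
  absorb false true  b⇒a = ⊥-elim (b⇒a tt)
  absorb false false _   = refl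

double-count : ∀ {m n} (P : Fin m → Bool) (Q : Fin n → Bool) (R : Fin m → Fin n → Bool) →
               ∑[ i ∈ P ] count (λ j → Q j ∧ R i j) ≡ ∑[ j ∈ Q ] count (λ i → P i ∧ R i j)
double-count P Q R = begin
  ∑[ i ∈ P ] count (λ j → Q j ∧ R i j)
    ≡⟨ ∑∈-cong P (λ i _ → count≡∑∈ (λ j → Q j ∧ R i j)) ⟩
  ∑[ i ∈ P ] ∑[ j ∈ (λ j → Q j ∧ R i j) ] 1
    ≡⟨ ∑∈-comm P Q R (λ _ _ → 1) ⟩
  ∑[ j ∈ Q ] ∑[ i ∈ (λ i → P i ∧ R i j) ] 1
    ≡⟨ ∑∈-cong Q (λ j _ → count≡∑∈ (λ i → P i ∧ R i j)) ⟨
  ∑[ j ∈ Q ] count (λ i → P i ∧ R i j)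
    ∎
  where open ≡-Reasoning

2*-cancel-≤ : ∀ {m n} → suc m + 2 * n ≤ suc n + 2 * m → n ≤ m
2*-cancel-≤ {m} {n} h = +-cancelˡ-≤ (suc (m + n)) n m (subst₂ _≤_ (lhs m n) (rhs m n) h)
  where
  lhs : ∀ m n → suc m + 2 * n ≡ suc (m + n) + n
  lhs = solve-∀
  rhs : ∀ m n → suc n + 2 * m ≡ suc (m + n) + m
  rhs = solve-∀

cross-< : ∀ {s t a b r k} → t < s → k ≤ r → 0 < k → t ≡ r + a → s ≡ k + b → s * a < t * b
cross-< {s} {t} {a} {b} {r} {k} t<s k≤r 0<k t≡r+a s≡k+b = +-cancelˡ-< (s * r) (s * a) (t * b) (begin-strict
  s * r + s * a ≡⟨ *-distribˡ-+ s r a ⟨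
  s * (r + a)   ≡⟨ cong (s *_) t≡r+a ⟨
  s * t         ≡⟨ cong (_* t) s≡k+b ⟩
  (k + b) * t   ≡⟨ *-distribʳ-+ t k b ⟩
  k * t + b * t <⟨ +-monoˡ-< (b * t) tk<sr ⟩
  s * r + b * t ≡⟨ cong (s * r +_) (*-comm b t) ⟩
  s * r + t * b ∎)
  where
  open ≤-Reasoning
  tk<sr : k * t < s * r
  tk<sr = begin-strict
    k * t ≡⟨ *-comm k t ⟩
    t * k <⟨ *-monoˡ-< k {{>-nonZero 0<k}} t<s ⟩
    s * k ≤⟨ *-monoʳ-≤ s k≤r ⟩
    s * r ∎

*≡*-<⇒> : ∀ {p q f g} → p * f ≡ q * g → f < g → 0 < q * g → q < p
*≡*-<⇒> {q = zero} _ _ ()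
*≡*-<⇒> {p} {q@(suc _)} {f} {g} pf≡qg f<g _ with p ≤? q
... | no  p≰q = ≰⇒> p≰q
... | yes p≤q = ⊥-elim (<-irrefl pf≡qg (begin-strict
  p * f ≤⟨ *-monoˡ-≤ f p≤q ⟩
  q * f <⟨ *-monoʳ-< q f<g ⟩
  q * g ∎))
  where open ≤-Reasoning

∸1+𝟙[0<]≤ : ∀ {k l} → (2 ≤ k → k ≤ l) → (k ∸ 1) + 𝟙 (0 <ᵇ l) ≤ l
∸1+𝟙[0<]≤ {0}             _   = 𝟙[0<]≤ _
∸1+𝟙[0<]≤ {1}             _   = 𝟙[0<]≤ _
∸1+𝟙[0<]≤ {suc (suc j)} {l} k≤l with k≤l (s≤s (s≤s z≤n))
... | s≤s j+1≤l′ = subst (_≤ l) (+-comm 1 (suc j)) (s≤s j+1≤l′)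

^-cancelʳ-≤ : ∀ {m} → 1 < m → ∀ {p q} → m ^ p ≤ m ^ q → p ≤ q
^-cancelʳ-≤ {m} 1<m {p} {q} mᵖ≤mᵠ with p ≤? q
... | yes p≤q = p≤q
... | no  p≰q = ⊥-elim (<⇒≱ (^-monoʳ-< m 1<m (≰⇒> p≰q)) mᵖ≤mᵠ)

n<m^n : ∀ {m} → 1 < m → ∀ n → n < m ^ n
n<m^n 1<m zero    = z<s
n<m^n 1<m (suc n) = ≤-<-trans (n<m^n 1<m n) (^-monoʳ-< _ 1<m (n<1+n n))

-- Graphs, with vertex sets as predicates Fin n → Bool; the primed notions mirror those of Defs

degIn : ∀ {n} → BipGraph n → (Fin n → Bool) → Fin n → ℕ
degIn G S y = count (λ x → S x ∧ G x y)

Λ²′ : ∀ {n} → BipGraph n → (Fin n → Bool) → Fin n → Bool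
Λ²′ G S y = 2 ≤ᵇ degIn G S y

DoubleHall′ : ∀ {n} → BipGraph n → Set
DoubleHall′ G = ∀ S → 2 ≤ count S → count S ≤ count (Λ²′ G S)

Regular′ : ∀ {n} → ℕ → BipGraph n → Set
Regular′ d G = (∀ x → count (G x) ≡ d) × (∀ y → count (λ x → G x y) ≡ d)

∣tabulate∣≡count : ∀ {n} (P : Fin n → Bool) → ∣ tabulate P ∣ ≡ count P
∣tabulate∣≡count P = trans (∣∣≡count (tabulate P)) (count-cong (lookup∘tabulate P))

∣Λ²∣≡count : ∀ {n} (G : BipGraph n) (S : Subset n) → ∣ Λ² G S ∣ ≡ count (Λ²′ G (lookup S))
∣Λ²∣≡count G S = trans (∣tabulate∣≡count _) (count-cong λ y → cong (2 ≤ᵇ_) (begin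
  ∣ S ∩ nbrY G y ∣
    ≡⟨ ∣∣≡count (S ∩ nbrY G y) ⟩
  count (lookup (S ∩ nbrY G y))
    ≡⟨ count-cong (λ x → lookup-zipWith _∧_ x S (nbrY G y)) ⟩
  count (λ x → lookup S x ∧ lookup (nbrY G y) x)
    ≡⟨ count-cong (λ x → cong (lookup S x ∧_) (lookup∘tabulate (λ x → G x y) x)) ⟩
  degIn G (lookup S) y
    ∎))
  where open ≡-Reasoning

Regular′⇒Regular : ∀ {n d} {G : BipGraph n} → Regular′ d G → Regular d G
Regular′⇒Regular {G = G} (degX , degY) =
  (λ x → trans (∣tabulate∣≡count (G x)) (degX x)) ,
  (λ y → trans (∣tabulate∣≡count (λ x → G x y)) (degY y))

DoubleHall′⇒DoubleHall : ∀ {n} {G : BipGraph n} → 2 ≤ n → DoubleHall′ G → DoubleHall G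
DoubleHall′⇒DoubleHall {G = G} 2≤n dh = 2≤n , λ S 2≤∣S∣ →
  subst₂ _≤_ (sym (∣∣≡count S)) (sym (∣Λ²∣≡count G S))
             (dh (lookup S) (subst (2 ≤_) (∣∣≡count S) 2≤∣S∣))

-- Weighting each edge xy by 1/(|A| deg x) gives total at most 1, weighting it by 1/(|B| deg y)
-- gives exactly 1; p x and q y are these weights multiplied by a common denominator L.  The ⊔ 1
-- only keeps L positive: it changes nothing at vertices of positive degree.
module EdgeWeights {m n} (A : Fin m → Bool) (B : Fin n → Bool) (E : Fin m → Fin n → Bool) where

  degᴬ : Fin m → ℕ
  degᴬ x = count (λ y → B y ∧ E x y)

  degᴮ : Fin n → ℕ
  degᴮ y = count (λ x → A x ∧ E x y)

  private
    f : Fin m → ℕ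
    f x = count A * degᴬ x ⊔ 1

    g : Fin n → ℕ
    g y = count B * degᴮ y ⊔ 1

    f∣L : ∀ x → f x ∣ ∏ f * ∏ g
    f∣L x = ∣-trans (∣∏ f x) (m∣m*n (∏ g))

    g∣L : ∀ y → g y ∣ ∏ f * ∏ g
    g∣L y = ∣-trans (∣∏ g y) (n∣m*n (∏ f))

  L : ℕ
  L = ∏ f * ∏ g

  p : Fin m → ℕ
  p x = _∣_.quotient (f∣L x)

  q : Fin n → ℕ
  q y = _∣_.quotient (g∣L y)

  private
    L-pos : 0 < L
    L-pos = *-mono-≤ (∏-pos λ x → m≤n⊔m (count A * degᴬ x) 1)
                     (∏-pos λ y → m≤n⊔m (count B * degᴮ y) 1)

    f≡ : ∀ {x} → T (A x) → 0 < degᴬ x → f x ≡ count A * degᴬ x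
    f≡ Ax 0<deg = m≥n⇒m⊔n≡m (*-mono-≤ (count-pos A Ax) 0<deg)

    g≡ : ∀ {y} → T (B y) → 0 < degᴮ y → g y ≡ count B * degᴮ y
    g≡ By 0<deg = m≥n⇒m⊔n≡m (*-mono-≤ (count-pos B By) 0<deg)

  weightᴬ≤L : ∀ {x} → T (A x) → count A * (p x * degᴬ x) ≤ L
  weightᴬ≤L {x} Ax = bound (degᴬ x) λ 0<deg →
    trans (cong (p x *_) (sym (f≡ Ax 0<deg))) (sym (_∣_.equality (f∣L x)))
    where
    bound : ∀ k → (0 < k → p x * (count A * k) ≡ L) → count A * (p x * k) ≤ L
    bound zero      _     = subst (_≤ L) (sym (trans (cong (count A *_) (*-zeroʳ (p x))) (*-zeroʳ (count A)))) z≤n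
    bound k@(suc _) exact = ≤-reflexive (trans (*-exchange (count A) (p x) k) (exact z<s))

  weightᴮ≡L : ∀ {y} → T (B y) → 0 < degᴮ y → count B * (q y * degᴮ y) ≡ L
  weightᴮ≡L {y} By 0<deg = begin
    count B * (q y * degᴮ y) ≡⟨ *-exchange (count B) (q y) (degᴮ y) ⟩
    q y * (count B * degᴮ y) ≡⟨ cong (q y *_) (g≡ By 0<deg) ⟨
    q y * g y                ≡⟨ _∣_.equality (g∣L y) ⟨
    L                        ∎
    where open ≡-Reasoning

  q<p : ∀ {x y} → T (A x) → T (B y) → T (E x y) → count A * degᴬ x < count B * degᴮ y → q y < p x
  q<p {x} {y} Ax By Exy dominated =
    *≡*-<⇒> (trans (sym (_∣_.equality (f∣L x))) (_∣_.equality (g∣L y)))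
            (subst₂ _<_ (sym (f≡ Ax (count-pos _ (∧-intro By Exy))))
                        (sym (g≡ By (count-pos _ (∧-intro Ax Exy)))) dominated)
            (subst (0 <_) (_∣_.equality (g∣L y)) L-pos)

no-edgewise-domination :
  ∀ {m n} (A : Fin m → Bool) (B : Fin n → Bool) (E : Fin m → Fin n → Bool) →
  (∀ y → T (B y) → 0 < count (λ x → A x ∧ E x y)) → ∀ {y₀} → T (B y₀) →
  ¬ (∀ x y → T (A x) → T (B y) → T (E x y) →
       count A * count (λ y′ → B y′ ∧ E x y′) < count B * count (λ x′ → A x′ ∧ E x′ y))
no-edgewise-domination A B E B-covered {y₀} By₀ dominated = <-irrefl refl (begin-strict
  L
    ≡⟨ ∑ᴮ≡L ⟨
  ∑[ y ∈ B ] (q y * degᴮ y)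
    ≡⟨ ∑∈-cong B (λ y _ → ∑∈-const (λ x → A x ∧ E x y) (q y)) ⟨
  ∑[ y ∈ B ] ∑[ x ∈ (λ x → A x ∧ E x y) ] q y
    ≡⟨ ∑∈-comm A B E (λ _ y → q y) ⟨
  ∑[ x ∈ A ] ∑[ y ∈ (λ y → B y ∧ E x y) ] q y
    <⟨ ∑∈-mono-< A (λ x Ax → ∑∈-mono _ λ y → <⇒≤ ∘ q<p′ Ax) Ax₀
                   (∑∈-mono-< _ (λ y → <⇒≤ ∘ q<p′ Ax₀) BEx₀y₀ (q<p′ Ax₀ BEx₀y₀)) ⟩
  ∑[ x ∈ A ] ∑[ y ∈ (λ y → B y ∧ E x y) ] p x
    ≡⟨ ∑∈-cong A (λ x _ → ∑∈-const (λ y → B y ∧ E x y) (p x)) ⟩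
  ∑[ x ∈ A ] (p x * degᴬ x)
    ≤⟨ ∑ᴬ≤L ⟩
  L ∎)
  where
  open EdgeWeights A B E
  open ≤-Reasoning

  edge₀ : ∃[ x ] T (A x ∧ E x y₀)
  edge₀ = count-witness (λ x → A x ∧ E x y₀) (B-covered y₀ By₀)
  x₀ = proj₁ edge₀
  Ax₀ = proj₁ (∧-elim (A x₀) (proj₂ edge₀))
  BEx₀y₀ = ∧-intro By₀ (proj₂ (∧-elim (A x₀) (proj₂ edge₀)))

  q<p′ : ∀ {x y} → T (A x) → T (B y ∧ E x y) → q y < p x
  q<p′ {x} {y} Ax BExy = let By , Exy = ∧-elim (B y) BExy in q<p Ax By Exy (dominated x y Ax By Exy)

  ∑ᴬ≤L : ∑[ x ∈ A ] (p x * degᴬ x) ≤ L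
  ∑ᴬ≤L = *-cancelˡ-≤ (count A) {{>-nonZero (count-pos A Ax₀)}} (begin
    count A * ∑[ x ∈ A ] (p x * degᴬ x)   ≡⟨ ∑∈-*ˡ A (count A) (λ x → p x * degᴬ x) ⟩
    ∑[ x ∈ A ] (count A * (p x * degᴬ x)) ≤⟨ ∑∈-mono A (λ x → weightᴬ≤L) ⟩
    ∑[ x ∈ A ] L                          ≡⟨ ∑∈-const A L ⟩
    L * count A                           ≡⟨ *-comm L (count A) ⟩
    count A * L                           ∎)

  ∑ᴮ≡L : ∑[ y ∈ B ] (q y * degᴮ y) ≡ L
  ∑ᴮ≡L = *-cancelˡ-≡ _ L (count B) {{>-nonZero (count-pos B By₀)}} (begin-equality
    count B * ∑[ y ∈ B ] (q y * degᴮ y)   ≡⟨ ∑∈-*ˡ B (count B) (λ y → q y * degᴮ y) ⟩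
    ∑[ y ∈ B ] (count B * (q y * degᴮ y)) ≡⟨ ∑∈-cong B (λ y By → weightᴮ≡L By (B-covered y By)) ⟩
    ∑[ y ∈ B ] L                          ≡⟨ ∑∈-const B L ⟩
    L * count B                           ≡⟨ *-comm L (count B) ⟩
    count B * L                           ∎)

-- Biplanes

record IsBiplane {n} (G : BipGraph n) : Set where
  field
    common-nbrsˣ : ∀ {x x′} → x ≢ x′ → count (λ y → G x y ∧ G x′ y) ≡ 2
    common-nbrsʸ : ∀ {y y′} → y ≢ y′ → count (λ x → G x y ∧ G x y′) ≡ 2

module Biplane {n} {G : BipGraph n} (biplane : IsBiplane G) (S : Fin n → Bool) where
  open IsBiplane biplane

  Λ : Fin n → Bool
  Λ = Λ²′ G S

  degΛ : Fin n → ℕ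
  degΛ x = count (λ y → Λ y ∧ G x y)

  nonNbrs : Fin n → ℕ
  nonNbrs y = count (λ x → S x ∧ not (G x y))

  Λ-intro : ∀ {x x′ y} → x ≢ x′ → T (S x) → T (S x′) → T (G x y) → T (G x′ y) → T (Λ y)
  Λ-intro {y = y} x≢x′ Sx Sx′ Gxy Gx′y =
    ≤⇒≤ᵇ (count-≥2 (λ z → S z ∧ G z y) x≢x′ (∧-intro Sx Gxy) (∧-intro Sx′ Gx′y))

  common-nbrs-in-Λ : ∀ {x z} → x ≢ z → T (S x) → T (S z) →
                     count (λ y → (Λ y ∧ G x y) ∧ G z y) ≡ 2
  common-nbrs-in-Λ {x} {z} x≢z Sx Sz = begin
    count (λ y → (Λ y ∧ G x y) ∧ G z y) ≡⟨ count-cong (λ y → ∧-assoc (Λ y) (G x y) (G z y)) ⟩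
    count (λ y → Λ y ∧ (G x y ∧ G z y)) ≡⟨ count-∧-absorbʳ in-Λ ⟩
    count (λ y → G x y ∧ G z y)         ≡⟨ common-nbrsˣ x≢z ⟩
    2                                   ∎
    where
    open ≡-Reasoning
    in-Λ : ∀ y → T (G x y ∧ G z y) → T (Λ y)
    in-Λ y h = let Gxy , Gzy = ∧-elim (G x y) h in Λ-intro x≢z Sx Sz Gxy Gzy

  Λ-nonempty : 2 ≤ count S → ∃[ y ] T (Λ y)
  Λ-nonempty 2≤S =
    let x , x′ , x≢x′ , Sx , Sx′ = count-two S 2≤S
        y , h = count-witness (λ y → G x y ∧ G x′ y) (subst (0 <_) (sym (common-nbrsˣ x≢x′)) z<s)
        Gxy , Gx′y = ∧-elim (G x y) h
    in y , Λ-intro x≢x′ Sx Sx′ Gxy Gx′y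

  degΛ≤count-Λ : ∀ x → degΛ x ≤ count Λ
  degΛ≤count-Λ x = count-mono λ y h → proj₁ (∧-elim (Λ y) h)

  -- Each z ∈ S ∩ N(y) has its two common neighbours with x in Λ ∩ N(x), and each
  -- y′ ∈ Λ ∩ N(x) has at most two common neighbours with y.
  degIn≤degΛ : ∀ {x y} → T (S x) → T (Λ y) → ¬ T (G x y) → degIn G S y ≤ degΛ x
  degIn≤degΛ {x} {y} Sx Λy ¬Gxy = *-cancelˡ-≤ 2 (begin
    2 * count Sʸ                             ≡⟨ ∑∈-const Sʸ 2 ⟨
    ∑[ z ∈ Sʸ ] 2                            ≡⟨ ∑∈-cong Sʸ two ⟨
    ∑[ z ∈ Sʸ ] count (λ y′ → A y′ ∧ G z y′) ≡⟨ double-count Sʸ A G ⟩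
    ∑[ y′ ∈ A ] count (λ z → Sʸ z ∧ G z y′)  ≤⟨ ∑∈-mono A ≤2 ⟩
    ∑[ y′ ∈ A ] 2                            ≡⟨ ∑∈-const A 2 ⟩
    2 * count A                              ∎)
    where
    open ≤-Reasoning
    Sʸ A : Fin n → Bool
    Sʸ z = S z ∧ G z y
    A y′ = Λ y′ ∧ G x y′
    two : ∀ z → T (Sʸ z) → count (λ y′ → A y′ ∧ G z y′) ≡ 2
    two z Sʸz = let Sz , Gzy = ∧-elim (S z) Sʸz in common-nbrs-in-Λ (λ { refl → ¬Gxy Gzy }) Sx Sz
    ≤2 : ∀ y′ → T (A y′) → count (λ z → Sʸ z ∧ G z y′) ≤ 2
    ≤2 y′ Ay′ = begin
      count (λ z → Sʸ z ∧ G z y′)  ≤⟨ count-mono (λ z h → let Sʸz , Gzy′ = ∧-elim (Sʸ z) h in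
                                                         ∧-intro (proj₂ (∧-elim (S z) Sʸz)) Gzy′) ⟩
      count (λ z → G z y ∧ G z y′) ≡⟨ common-nbrsʸ (λ { refl → ¬Gxy (proj₂ (∧-elim (Λ y′) Ay′)) }) ⟩
      2                            ∎

  -- Double count the pairs (z , y) with z ∈ S, y ∈ Λ ∩ N(x₀) and z ∈ N(y): the point x₀ gives
  -- degΛ x₀ and every other z exactly 2, while y₀ gives |S| and every other y at most 2.
  full-block⇒count-S≤degΛ : ∀ {x₀ y₀} → T (S x₀) → T (Λ y₀) → (∀ z → T (S z) → T (G z y₀)) →
                            count S ≤ degΛ x₀
  full-block⇒count-S≤degΛ {x₀} {y₀} Sx₀ Λy₀ S⊆N[y₀] =
    subst₂ _≤_ (sym (count-remove S Sx₀)) (sym (count-remove A Ay₀)) (s≤s (2*-cancel-≤ (begin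
    suc (count (A - y₀)) + 2 * count (S - x₀)
      ≡⟨ cong (_+ 2 * count (S - x₀)) (count-remove A Ay₀) ⟨
    count A + 2 * count (S - x₀)
      ≡⟨ cong₂ _+_ (count-∧-absorbˡ λ y Ay → proj₂ (∧-elim (Λ y) Ay)) (∑∈-const (S - x₀) 2) ⟨
    count (λ y → A y ∧ G x₀ y) + ∑[ z ∈ S - x₀ ] 2
      ≡⟨ cong (count (λ y → A y ∧ G x₀ y) +_) (∑∈-cong (S - x₀) two) ⟨
    count (λ y → A y ∧ G x₀ y) + ∑[ z ∈ S - x₀ ] count (λ y → A y ∧ G z y)
      ≡⟨ ∑∈-remove S _ Sx₀ ⟨
    ∑[ z ∈ S ] count (λ y → A y ∧ G z y)
      ≡⟨ double-count S A G ⟩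
    ∑[ y ∈ A ] degIn G S y
      ≡⟨ ∑∈-remove A (degIn G S) Ay₀ ⟩
    degIn G S y₀ + ∑[ y ∈ A - y₀ ] degIn G S y
      ≤⟨ +-mono-≤ (count-mono λ z h → proj₁ (∧-elim (S z) h)) (∑∈-mono (A - y₀) ≤2) ⟩
    count S + ∑[ y ∈ A - y₀ ] 2
      ≡⟨ cong₂ _+_ (count-remove S Sx₀) (∑∈-const (A - y₀) 2) ⟩
    suc (count (S - x₀)) + 2 * count (A - y₀)
      ∎)))
    where
    open ≤-Reasoning
    A : Fin n → Bool
    A y = Λ y ∧ G x₀ y
    Ay₀ : T (A y₀)
    Ay₀ = ∧-intro Λy₀ (S⊆N[y₀] x₀ Sx₀)
    two : ∀ z → T ((S - x₀) z) → count (λ y → A y ∧ G z y) ≡ 2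
    two z h = let x₀≢z , Sz = -⁻ {P = S} h in common-nbrs-in-Λ x₀≢z Sx₀ Sz
    ≤2 : ∀ y → T ((A - y₀) y) → degIn G S y ≤ 2
    ≤2 y h = begin
      degIn G S y                  ≤⟨ count-mono (λ z h′ → let Sz , Gzy = ∧-elim (S z) h′ in
                                                          ∧-intro (S⊆N[y₀] z Sz) Gzy) ⟩
      count (λ z → G z y₀ ∧ G z y) ≡⟨ common-nbrsʸ (proj₁ (-⁻ {P = A} h)) ⟩
      2                            ∎

  nonNbrs≡0⇒full : ∀ {y} → nonNbrs y ≡ 0 → ∀ z → T (S z) → T (G z y)
  nonNbrs≡0⇒full {y} ≡0 z Sz with T? (G z y)
  ... | yes Gzy = Gzy
  ... | no ¬Gzy =
    ⊥-elim (<-irrefl (sym ≡0) (count-pos (λ x → S x ∧ not (G x y)) (∧-intro Sz (not-intro ¬Gzy))))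

  ¬count-Λ<count-S : 2 ≤ count S → ¬ (count Λ < count S)
  ¬count-Λ<count-S 2≤S Λ<S with any? (λ y → T? (Λ y ∧ (nonNbrs y ≡ᵇ 0)))
  ... | yes (y₀ , h) =
    let Λy₀ , ≡0 = ∧-elim (Λ y₀) h
        x₀ , Sx₀ = count-witness S (≤-trans (s≤s z≤n) 2≤S)
        S≤degΛ = full-block⇒count-S≤degΛ Sx₀ Λy₀ (nonNbrs≡0⇒full (≡ᵇ⇒≡ _ 0 ≡0))
    in <⇒≱ Λ<S (≤-trans S≤degΛ (degΛ≤count-Λ x₀))
  ... | no ¬full =
    no-edgewise-domination S Λ (λ x y → not (G x y)) covered (proj₂ (Λ-nonempty 2≤S)) dominated
    where
    covered : ∀ y → T (Λ y) → 0 < nonNbrs y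
    covered y Λy = n≢0⇒n>0 λ ≡0 → ¬full (y , ∧-intro Λy (≡⇒≡ᵇ (nonNbrs y) 0 ≡0))
    dominated : ∀ x y → T (S x) → T (Λ y) → T (not (G x y)) →
                count S * count (λ y′ → Λ y′ ∧ not (G x y′)) < count Λ * nonNbrs y
    dominated x y Sx Λy ¬Gxy =
      cross-< Λ<S (degIn≤degΛ Sx Λy (not-elim (G x y) ¬Gxy))
              (≤-trans (s≤s z≤n) (≤ᵇ⇒≤ 2 (degIn G S y) Λy))
              (count-split Λ (G x)) (count-split S (λ z → G z y))

biplane⇒doubleHall : ∀ {n} {G : BipGraph n} → IsBiplane G → DoubleHall′ G
biplane⇒doubleHall biplane S 2≤S = ≮⇒≥ (Biplane.¬count-Λ<count-S biplane S 2≤S)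

-- Tensor products

sum-∑∈-regular : ∀ {m n d} (P : Fin m → Fin n → Bool) → (∀ i → count (P i) ≡ d) →
                 (f : Fin m → ℕ) → ∑[ i < m ] ∑[ j ∈ P i ] f i ≡ d * sum f
sum-∑∈-regular {d = d} P deg f = trans
  (sum-cong-≗ λ i → trans (∑∈-const (P i) (f i)) (trans (cong (f i *_) (deg i)) (*-comm (f i) d)))
  (sym (*-distribˡ-sum d f))

-- Multiplied by d, both sides become sums over the edges.
regular-sum-≤ : ∀ {m d} {G : BipGraph m} → Regular′ d G → 0 < d → {u v w : Fin m → ℕ} →
                (∀ a y → T (G a y) → u a + v y ≤ w y) → sum u + sum v ≤ sum w
regular-sum-≤ {m} {d} {G} (degX , degY) 0<d {u} {v} {w} edge-bound =
  *-cancelˡ-≤ d {{>-nonZero 0<d}} (begin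
  d * (sum u + sum v)
    ≡⟨ *-distribˡ-+ d (sum u) (sum v) ⟩
  d * sum u + d * sum v
    ≡⟨ cong₂ _+_ d∑u d∑v ⟩
  ∑[ y < m ] ∑[ a ∈ N y ] u a + ∑[ y < m ] ∑[ a ∈ N y ] v y
    ≡⟨ ∑-distrib-+ (λ y → ∑[ a ∈ N y ] u a) (λ y → ∑[ a ∈ N y ] v y) ⟨
  ∑[ y < m ] (∑[ a ∈ N y ] u a + ∑[ a ∈ N y ] v y)
    ≡⟨ sum-cong-≗ (λ y → ∑∈-distrib-+ (N y) u (λ _ → v y)) ⟨
  ∑[ y < m ] ∑[ a ∈ N y ] (u a + v y)
    ≤⟨ sum-mono-≤ (λ y → ∑∈-mono (N y) λ a → edge-bound a y) ⟩
  ∑[ y < m ] ∑[ a ∈ N y ] w y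
    ≡⟨ sum-∑∈-regular N degY w ⟩
  d * sum w
    ∎)
  where
  open ≤-Reasoning
  N : Fin m → Fin m → Bool
  N y a = G a y
  d∑u : d * sum u ≡ ∑[ y < m ] ∑[ a ∈ N y ] u a
  d∑u = trans (sym (sum-∑∈-regular G degX u)) (∑∈-swap G (λ a _ → u a))
  d∑v : d * sum v ≡ ∑[ y < m ] ∑[ a ∈ N y ] v y
  d∑v = sym (sum-∑∈-regular N degY v)

_⊗_ : ∀ {m n} → BipGraph m → BipGraph n → BipGraph (m * n)
(_⊗_ {m} {n} G H) p q = G (proj₁ pᵐⁿ) (proj₁ qᵐⁿ) ∧ H (proj₂ pᵐⁿ) (proj₂ qᵐⁿ)
  where
  pᵐⁿ = remQuot {m} n p
  qᵐⁿ = remQuot {m} n q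

⊗-combine : ∀ {m n} (G : BipGraph m) (H : BipGraph n) a b c e →
            (G ⊗ H) (combine a b) (combine c e) ≡ G a c ∧ H b e
⊗-combine G H a b c e = cong₂ (λ ab ce → G (proj₁ ab) (proj₁ ce) ∧ H (proj₂ ab) (proj₂ ce))
                              (remQuot-combine a b) (remQuot-combine c e)

count-× : ∀ {m n} (P : Fin m → Bool) (Q : Fin n → Bool) →
          count (λ p → P (proj₁ (remQuot {m} n p)) ∧ Q (proj₂ (remQuot {m} n p))) ≡ count P * count Q
count-× {m} {n} P Q = begin
  count (λ p → P (proj₁ (remQuot {m} n p)) ∧ Q (proj₂ (remQuot {m} n p)))
    ≡⟨ count-combine {m} {n} _ ⟩
  ∑[ i < m ] count (λ j → P (proj₁ (remQuot {m} n (combine i j))) ∧ Q (proj₂ (remQuot {m} n (combine i j))))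
    ≡⟨ sum-cong-≗ (λ i → count-cong λ j →
         cong (λ ij → P (proj₁ ij) ∧ Q (proj₂ ij)) (remQuot-combine i j)) ⟩
  ∑[ i < m ] count (λ j → P i ∧ Q j)
    ≡⟨ sum-count-∧ P (λ _ → Q) ⟩
  ∑[ i ∈ P ] count Q
    ≡⟨ ∑∈-const P (count Q) ⟩
  count Q * count P
    ≡⟨ *-comm (count Q) (count P) ⟩
  count P * count Q
    ∎
  where open ≡-Reasoning

⊗-regular : ∀ {m n d e} {G : BipGraph m} {H : BipGraph n} →
            Regular′ d G → Regular′ e H → Regular′ (d * e) (G ⊗ H)
⊗-regular {m} {n} (degGX , degGY) (degHX , degHY) =
  (λ p → let a , b = remQuot {m} n p in trans (count-× _ _) (cong₂ _*_ (degGX a) (degHX b))) ,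
  (λ q → let c , e = remQuot {m} n q in trans (count-× _ _) (cong₂ _*_ (degGY c) (degHY e)))

-- The fibre of Λ²(S) over y has at least |S_a| elements when a ∈ N(y) and |S_a| ≥ 2 (double
-- Hall for H applied to the slice S_a), and is nonempty when N(y) meets two nonempty slices;
-- double Hall for G provides at least as many such y as there are nonempty slices.
module Product {m n d} {G : BipGraph m} {H : BipGraph n}
  (G-regular : Regular′ d G) (0<d : 0 < d) (G-doubleHall : DoubleHall′ G)
  (H-doubleHall : DoubleHall′ H) (H-nbr : ∀ b → 0 < count (H b))
  (S : Fin (m * n) → Bool) where

  Λ : Fin (m * n) → Bool
  Λ = Λ²′ (G ⊗ H) S

  slice : Fin m → Fin n → Bool
  slice a b = S (combine a b)

  nonempty : Fin m → Bool
  nonempty a = 0 <ᵇ count (slice a)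

  fibre : Fin m → ℕ
  fibre y = count (λ y′ → Λ (combine y y′))

  mult : Fin m → Fin n → ℕ
  mult y b = count (λ a → G a y ∧ slice a b)

  degIn-⊗ : ∀ y y′ → degIn (G ⊗ H) S (combine y y′) ≡ ∑[ b ∈ (λ b → H b y′) ] mult y b
  degIn-⊗ y y′ = begin
    count (λ p → S p ∧ (G ⊗ H) p (combine y y′))
      ≡⟨ count-combine {m} {n} _ ⟩
    ∑[ a < m ] count (λ b → slice a b ∧ (G ⊗ H) (combine a b) (combine y y′))
      ≡⟨ sum-cong-≗ (λ a → count-cong λ b → trans (cong (slice a b ∧_) (⊗-combine G H a b y y′))
                                                  (shuffle (slice a b) (G a y) (H b y′))) ⟩
    ∑[ a < m ] count (λ b → G a y ∧ (H b y′ ∧ slice a b))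
      ≡⟨ sum-count-∧ (λ a → G a y) (λ a b → H b y′ ∧ slice a b) ⟩
    ∑[ a ∈ (λ a → G a y) ] count (λ b → H b y′ ∧ slice a b)
      ≡⟨ double-count (λ a → G a y) (λ b → H b y′) slice ⟩
    ∑[ b ∈ (λ b → H b y′) ] mult y b
      ∎
    where
    open ≡-Reasoning
    shuffle : ∀ s x x′ → s ∧ (x ∧ x′) ≡ x ∧ (x′ ∧ s)
    shuffle s x x′ = trans (∧-comm s (x ∧ x′)) (∧-assoc x x′ s)

  Λ-⊗ : ∀ {y y′} {B : Fin n → Bool} → (∀ b → 𝟙 (B b) ≤ mult y b) → T (Λ²′ H B y′) →
        T (Λ (combine y y′))
  Λ-⊗ {y} {y′} {B} B≤mult Λ²By′ = ≤⇒≤ᵇ (begin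
    2                                ≤⟨ ≤ᵇ⇒≤ 2 _ Λ²By′ ⟩
    count (λ b → B b ∧ H b y′)       ≡⟨ count-cong (λ b → ∧-comm (B b) (H b y′)) ⟩
    count (λ b → H b y′ ∧ B b)       ≡⟨ count-∧≡∑∈ (λ b → H b y′) B ⟩
    ∑[ b ∈ (λ b → H b y′) ] 𝟙 (B b)  ≤⟨ ∑∈-mono _ (λ b _ → B≤mult b) ⟩
    ∑[ b ∈ (λ b → H b y′) ] mult y b ≡⟨ degIn-⊗ y y′ ⟨
    degIn (G ⊗ H) S (combine y y′)   ∎)
    where open ≤-Reasoning

  slice-bound : ∀ {a y} → T (G a y) → 2 ≤ count (slice a) → count (slice a) ≤ fibre y
  slice-bound {a} {y} Gay 2≤Sₐ = ≤-trans (H-doubleHall (slice a) 2≤Sₐ) (count-mono λ y′ →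
    Λ-⊗ λ b → ≤-trans (𝟙-mono (∧-intro Gay)) (𝟙≤count (λ a′ → G a′ y ∧ slice a′ b) a))

  pair-bound : ∀ {a a′ b b′ y} → a ≢ a′ → T (G a y) → T (G a′ y) →
               T (slice a b) → T (slice a′ b′) → 0 < fibre y
  pair-bound {a} {a′} {b} {b′} {y} a≢a′ Gay Ga′y Sab Sa′b′ with b ≟ b′
  ... | yes refl =
    let y′ , Hby′ = count-witness (H b) (H-nbr b)
        2≤mult = count-≥2 (λ a → G a y ∧ slice a b) a≢a′ (∧-intro Gay Sab) (∧-intro Ga′y Sa′b′)
    in count-pos (λ y′ → Λ (combine y y′)) {y′} (≤⇒≤ᵇ (begin
         2                                ≤⟨ 2≤mult ⟩
         mult y b                         ≤⟨ ≤-∑∈ (λ b → H b y′) (mult y) Hby′ ⟩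
         ∑[ b ∈ (λ b → H b y′) ] mult y b ≡⟨ degIn-⊗ y y′ ⟨
         degIn (G ⊗ H) S (combine y y′)   ∎))
    where open ≤-Reasoning
  ... | no b≢b′ =
    let Bb = <⇒<ᵇ (count-pos _ (∧-intro Gay Sab))
        Bb′ = <⇒<ᵇ (count-pos _ (∧-intro Ga′y Sa′b′))
        2≤B = count-≥2 B b≢b′ Bb Bb′
        y′ , Λ²By′ = count-witness (Λ²′ H B) (≤-trans (s≤s z≤n) (≤-trans 2≤B (H-doubleHall B 2≤B)))
    in count-pos (λ y′ → Λ (combine y y′)) {y′} (Λ-⊗ (λ b → 𝟙[0<]≤ (mult y b)) Λ²By′)
    where
    B : Fin n → Bool
    B b = 0 <ᵇ mult y b

  nonempty-bound : 2 ≤ count S → count nonempty ≤ count (λ y → 0 <ᵇ fibre y)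
  nonempty-bound 2≤S with 2 ≤? count nonempty
  ... | yes 2≤nonempty = ≤-trans (G-doubleHall nonempty 2≤nonempty) (count-mono λ y h →
    let a , a′ , a≢a′ , h₁ , h₂ = count-two (λ a → nonempty a ∧ G a y) (≤ᵇ⇒≤ 2 _ h)
        Sₐ≢∅ , Gay  = ∧-elim (nonempty a) h₁
        Sₐ′≢∅ , Ga′y = ∧-elim (nonempty a′) h₂
        b  , Sab   = count-witness (slice a) (<ᵇ⇒< 0 _ Sₐ≢∅)
        b′ , Sa′b′ = count-witness (slice a′) (<ᵇ⇒< 0 _ Sₐ′≢∅)
    in <⇒<ᵇ (pair-bound a≢a′ Gay Ga′y Sab Sa′b′))
  ... | no 2≰nonempty with any? (λ a → 2 ≤? count (slice a))
  ...   | yes (a , 2≤Sₐ) =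
    let y , Gay = count-witness (G a) (subst (0 <_) (sym (proj₁ G-regular a)) 0<d)
        0<fibre = ≤-trans (≤-trans (s≤s z≤n) 2≤Sₐ) (slice-bound Gay 2≤Sₐ)
    in ≤-trans (≤-pred (≰⇒> 2≰nonempty)) (count-pos (λ y → 0 <ᵇ fibre y) (<⇒<ᵇ 0<fibre))
  ...   | no small = ⊥-elim (2≰nonempty (subst (2 ≤_) count-S≡count-nonempty 2≤S))
    where
    ≤1⇒≡𝟙 : ∀ k → ¬ 2 ≤ k → k ≡ 𝟙 (0 <ᵇ k)
    ≤1⇒≡𝟙 0             _  = refl
    ≤1⇒≡𝟙 1             _  = refl
    ≤1⇒≡𝟙 (suc (suc k)) ≱2 = ⊥-elim (≱2 (s≤s (s≤s z≤n)))
    count-S≡count-nonempty : count S ≡ count nonempty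
    count-S≡count-nonempty = trans (count-combine {m} {n} S) (trans
      (sum-cong-≗ λ a → ≤1⇒≡𝟙 (count (slice a)) λ 2≤Sₐ → small (a , 2≤Sₐ)) (sym (count≡sum nonempty)))

  doubleHall : 2 ≤ count S → count S ≤ count Λ
  doubleHall 2≤S = begin
    count S                                     ≡⟨ count-combine {m} {n} S ⟩
    ∑[ a < m ] count (slice a)                  ≡⟨ sum-cong-≗ (λ a → split (count (slice a))) ⟩
    ∑[ a < m ] (𝟙 (nonempty a) + excess a)      ≡⟨ ∑-distrib-+ (𝟙 ∘ nonempty) excess ⟩
    ∑[ a < m ] 𝟙 (nonempty a) + sum excess      ≡⟨ cong (_+ sum excess) (count≡sum nonempty) ⟨
    count nonempty + sum excess                 ≤⟨ +-monoˡ-≤ (sum excess) (nonempty-bound 2≤S) ⟩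
    count (λ y → 0 <ᵇ fibre y) + sum excess     ≡⟨ +-comm (count (λ y → 0 <ᵇ fibre y)) (sum excess) ⟩
    sum excess + count (λ y → 0 <ᵇ fibre y)     ≡⟨ cong (sum excess +_) (count≡sum _) ⟩
    sum excess + ∑[ y < m ] 𝟙 (0 <ᵇ fibre y)    ≤⟨ regular-sum-≤ G-regular 0<d edge-bound ⟩
    sum fibre                                   ≡⟨ count-combine {m} {n} Λ ⟨
    count Λ                                     ∎
    where
    open ≤-Reasoning
    excess : Fin m → ℕ
    excess a = count (slice a) ∸ 1
    edge-bound : ∀ a y → T (G a y) → excess a + 𝟙 (0 <ᵇ fibre y) ≤ fibre y
    edge-bound a y Gay = ∸1+𝟙[0<]≤ (slice-bound Gay)
    split : ∀ k → k ≡ 𝟙 (0 <ᵇ k) + (k ∸ 1)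
    split zero    = refl
    split (suc k) = refl

⊗-doubleHall : ∀ {m n d} {G : BipGraph m} {H : BipGraph n} → Regular′ d G → 0 < d → DoubleHall′ G →
               DoubleHall′ H → (∀ b → 0 < count (H b)) → DoubleHall′ (G ⊗ H)
⊗-doubleHall G-regular 0<d G-doubleHall H-doubleHall H-nbr S =
  Product.doubleHall G-regular 0<d G-doubleHall H-doubleHall H-nbr S

-- Incidence tables

-- Direct recursion rather than Data.Bool.ListAction.any: it keeps the table checks fast to normalise.
_∈ᵇ_ : ℕ → List ℕ → Bool
a ∈ᵇ []      = false
a ∈ᵇ (b ∷ L) = (a ≡ᵇ b) ∨ (a ∈ᵇ L)

distinct : List ℕ → Bool
distinct []      = true
distinct (a ∷ L) = not (a ∈ᵇ L) ∧ distinct L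

countᴸ : (ℕ → Bool) → List ℕ → ℕ
countᴸ P []      = 0
countᴸ P (a ∷ L) = 𝟙 (P a) + countᴸ P L

countᴸ-true : ∀ L → countᴸ (λ _ → true) L ≡ length L
countᴸ-true []      = refl
countᴸ-true (_ ∷ L) = cong suc (countᴸ-true L)

count-≡ᵇ-∧ : ∀ {n a} (P : ℕ → Bool) → a < n →
             count (λ (y : Fin n) → (toℕ y ≡ᵇ a) ∧ P (toℕ y)) ≡ 𝟙 (P a)
count-≡ᵇ-∧ {suc n} {zero}  P _ =
  trans (count-suc _) (trans (cong (𝟙 (P 0) +_) (count-none λ _ ())) (+-identityʳ _))
count-≡ᵇ-∧ {suc n} {suc a} P (s≤s a<n) = trans (count-suc _) (count-≡ᵇ-∧ (P ∘ suc) a<n)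

count-∈ᵇ-∧ : ∀ {n} (P : ℕ → Bool) L → T (distinct L) → T (all (_<ᵇ n) L) →
             count (λ (y : Fin n) → (toℕ y ∈ᵇ L) ∧ P (toℕ y)) ≡ countᴸ P L
count-∈ᵇ-∧ P []      _ _ = count-none λ _ ()
count-∈ᵇ-∧ {n} P (a ∷ L) dist bounded = begin
  count (λ y → ((toℕ y ≡ᵇ a) ∨ (toℕ y ∈ᵇ L)) ∧ P (toℕ y))
    ≡⟨ count-split _ (λ y → toℕ y ≡ᵇ a) ⟩
  count (λ y → (((toℕ y ≡ᵇ a) ∨ (toℕ y ∈ᵇ L)) ∧ P (toℕ y)) ∧ (toℕ y ≡ᵇ a)) +
  count (λ y → (((toℕ y ≡ᵇ a) ∨ (toℕ y ∈ᵇ L)) ∧ P (toℕ y)) ∧ not (toℕ y ≡ᵇ a))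
    ≡⟨ cong₂ _+_ (count-cong λ y → at-a (toℕ y ≡ᵇ a) _ _)
                 (count-cong λ y → off-a (toℕ y ≡ᵇ a) _ _ (a∉L y)) ⟩
  count (λ y → (toℕ y ≡ᵇ a) ∧ P (toℕ y)) + count (λ y → (toℕ y ∈ᵇ L) ∧ P (toℕ y))
    ≡⟨ cong₂ _+_ (count-≡ᵇ-∧ P (<ᵇ⇒< a n a<n)) (count-∈ᵇ-∧ P L distL boundedL) ⟩
  𝟙 (P a) + countᴸ P L ∎
  where
  open ≡-Reasoning
  a<n = proj₁ (∧-elim (a <ᵇ n) bounded)
  boundedL = proj₂ (∧-elim (a <ᵇ n) bounded)
  a∉ᵇL = proj₁ (∧-elim (not (a ∈ᵇ L)) dist)
  distL = proj₂ (∧-elim (not (a ∈ᵇ L)) dist)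
  at-a : ∀ e m p → ((e ∨ m) ∧ p) ∧ e ≡ e ∧ p
  at-a true  m p = ∧-identityʳ p
  at-a false m p = ∧-zeroʳ _
  off-a : ∀ e m p → (T e → ¬ T m) → ((e ∨ m) ∧ p) ∧ not e ≡ m ∧ p
  off-a true  true  p e⇒¬m = ⊥-elim (e⇒¬m tt tt)
  off-a true  false p _    = ∧-zeroʳ p
  off-a false m     p _    = ∧-identityʳ _
  a∉L : ∀ y → T (toℕ y ≡ᵇ a) → ¬ T (toℕ y ∈ᵇ L)
  a∉L y y≡a = subst (λ k → ¬ T (k ∈ᵇ L)) (sym (≡ᵇ⇒≡ (toℕ y) a y≡a)) (not-elim (a ∈ᵇ L) a∉ᵇL)

incidence : ∀ {n} → Vec (List ℕ) n → BipGraph n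
incidence blocks x y = toℕ y ∈ᵇ lookup blocks x

column : ∀ {n} → ℕ → Vec (List ℕ) n → List ℕ
column k []       = []
column k (B ∷ Bs) = if k ∈ᵇ B then 0 ∷ map suc (column k Bs) else map suc (column k Bs)

transposeᵗ : ∀ {n} → Vec (List ℕ) n → Vec (List ℕ) n
transposeᵗ blocks = tabulate λ y → column (toℕ y) blocks

0∈ᵇmap-suc : ∀ L → 0 ∈ᵇ map suc L ≡ false
0∈ᵇmap-suc []      = refl
0∈ᵇmap-suc (_ ∷ L) = 0∈ᵇmap-suc L

suc∈ᵇmap-suc : ∀ a L → suc a ∈ᵇ map suc L ≡ a ∈ᵇ L
suc∈ᵇmap-suc a []      = refl
suc∈ᵇmap-suc a (b ∷ L) = cong ((a ≡ᵇ b) ∨_) (suc∈ᵇmap-suc a L)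

∈ᵇ-column : ∀ {n} (blocks : Vec (List ℕ) n) x k → toℕ x ∈ᵇ column k blocks ≡ k ∈ᵇ lookup blocks x
∈ᵇ-column (B ∷ Bs) zero k with k ∈ᵇ B
... | true  = refl
... | false = 0∈ᵇmap-suc (column k Bs)
∈ᵇ-column (B ∷ Bs) (suc x) k with k ∈ᵇ B
... | true  = trans (suc∈ᵇmap-suc (toℕ x) (column k Bs)) (∈ᵇ-column Bs x k)
... | false = trans (suc∈ᵇmap-suc (toℕ x) (column k Bs)) (∈ᵇ-column Bs x k)

incidence-transposeᵗ : ∀ {n} (blocks : Vec (List ℕ) n) x y →
                       incidence (transposeᵗ blocks) y x ≡ incidence blocks x y
incidence-transposeᵗ blocks x y =
  trans (cong (toℕ x ∈ᵇ_) (lookup∘tabulate (λ y → column (toℕ y) blocks) y))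
        (∈ᵇ-column blocks x (toℕ y))

allᵛ : ∀ {A : Set} {n} → (A → Bool) → Vec A n → Bool
allᵛ P []       = true
allᵛ P (a ∷ as) = P a ∧ allᵛ P as

allPairsᵛ : ∀ {A : Set} {n} → (A → A → Bool) → Vec A n → Bool
allPairsᵛ R []       = true
allPairsᵛ R (a ∷ as) = allᵛ (R a) as ∧ allPairsᵛ R as

allᵛ-lookup : ∀ {A : Set} {n} (P : A → Bool) (v : Vec A n) → T (allᵛ P v) → ∀ i → T (P (lookup v i))
allᵛ-lookup P (a ∷ _)  h zero    = proj₁ (∧-elim (P a) h)
allᵛ-lookup P (a ∷ as) h (suc i) = allᵛ-lookup P as (proj₂ (∧-elim (P a) h)) i

allPairsᵛ-lookup : ∀ {A : Set} {n} (R : A → A → Bool) (v : Vec A n) → T (allPairsᵛ R v) →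
                   ∀ {i j} → i ≢ j → T (R (lookup v i) (lookup v j)) ⊎ T (R (lookup v j) (lookup v i))
allPairsᵛ-lookup R v        _ {zero}  {zero}  0≢0 = ⊥-elim (0≢0 refl)
allPairsᵛ-lookup R (a ∷ as) h {zero}  {suc j} _   = inj₁ (allᵛ-lookup (R a) as (proj₁ (∧-elim (allᵛ _ as) h)) j)
allPairsᵛ-lookup R (a ∷ as) h {suc i} {zero}  _   = inj₂ (allᵛ-lookup (R a) as (proj₁ (∧-elim (allᵛ _ as) h)) i)
allPairsᵛ-lookup R (a ∷ as) h {suc i} {suc j} i≢j =
  allPairsᵛ-lookup R as (proj₂ (∧-elim (allᵛ (R a) as) h)) (λ i≡j → i≢j (cong suc i≡j))

isBlock : ℕ → ℕ → List ℕ → Bool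
isBlock n d B = distinct B ∧ (all (_<ᵇ n) B ∧ (length B ≡ᵇ d))

isBlock-elim : ∀ {n d} B → T (isBlock n d B) → T (distinct B) × T (all (_<ᵇ n) B) × length B ≡ d
isBlock-elim {n} {d} B h =
  let dist , rest = ∧-elim (distinct B) h
      bounded , size = ∧-elim (all (_<ᵇ n) B) rest
  in dist , bounded , ≡ᵇ⇒≡ (length B) d size

meetTwice : List ℕ → List ℕ → Bool
meetTwice B B′ = countᴸ (_∈ᵇ B′) B ≡ᵇ 2

isDesign : ∀ {n} → ℕ → Vec (List ℕ) n → Bool
isDesign {n} d blocks = allᵛ (isBlock n d) blocks ∧ allPairsᵛ meetTwice blocks

isBiplaneTable : ∀ {n} → ℕ → Vec (List ℕ) n → Bool
isBiplaneTable d blocks = isDesign d blocks ∧ isDesign d (transposeᵗ blocks)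

module Design {n d} (blocks : Vec (List ℕ) n) (design : T (isDesign d blocks)) where

  private
    block : ∀ x → T (distinct (lookup blocks x)) × T (all (_<ᵇ n) (lookup blocks x)) ×
                  length (lookup blocks x) ≡ d
    block x = isBlock-elim {n} (lookup blocks x)
      (allᵛ-lookup (isBlock n d) blocks (proj₁ (∧-elim (allᵛ (isBlock n d) blocks) design)) x)

    count-∈ᵇ-block-∧ : ∀ (P : ℕ → Bool) x →
                       count (λ y → incidence blocks x y ∧ P (toℕ y)) ≡ countᴸ P (lookup blocks x)
    count-∈ᵇ-block-∧ P x = let dist , bounded , _ = block x in count-∈ᵇ-∧ P (lookup blocks x) dist bounded

    meet : ∀ {x x′} → T (meetTwice (lookup blocks x) (lookup blocks x′)) →
           count (λ y → incidence blocks x y ∧ incidence blocks x′ y) ≡ 2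
    meet {x} {x′} h = trans (count-∈ᵇ-block-∧ (_∈ᵇ lookup blocks x′) x) (≡ᵇ⇒≡ _ 2 h)

  degree : ∀ x → count (incidence blocks x) ≡ d
  degree x = begin
    count (incidence blocks x)                ≡⟨ count-cong (λ y → ∧-identityʳ _) ⟨
    count (λ y → incidence blocks x y ∧ true) ≡⟨ count-∈ᵇ-block-∧ (λ _ → true) x ⟩
    countᴸ (λ _ → true) (lookup blocks x)     ≡⟨ countᴸ-true (lookup blocks x) ⟩
    length (lookup blocks x)                  ≡⟨ proj₂ (proj₂ (block x)) ⟩
    d                                         ∎
    where open ≡-Reasoning

  common : ∀ {x x′} → x ≢ x′ → count (λ y → incidence blocks x y ∧ incidence blocks x′ y) ≡ 2
  common {x} {x′} x≢x′ with allPairsᵛ-lookup meetTwice blocks (proj₂ (∧-elim (allᵛ _ blocks) design)) x≢x′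
  ... | inj₁ h = meet h
  ... | inj₂ h = trans (count-cong λ y → ∧-comm (incidence blocks x y) _) (meet h)

biplaneTable-sound : ∀ {n d} (blocks : Vec (List ℕ) n) → T (isBiplaneTable d blocks) →
                     Regular′ d (incidence blocks) × IsBiplane (incidence blocks)
biplaneTable-sound {d = d} blocks h =
  ( Design.degree blocks rows
  , λ y → trans (count-cong λ x → sym (transposed x y)) (Design.degree blocksᵗ columns y) ) ,
  record
    { common-nbrsˣ = Design.common blocks rows
    ; common-nbrsʸ = λ {y} {y′} y≢y′ →
        trans (count-cong λ x → sym (cong₂ _∧_ (transposed x y) (transposed x y′)))
              (Design.common blocksᵗ columns y≢y′)
    }
  where
  blocksᵗ = transposeᵗ blocks
  rows = proj₁ (∧-elim (isDesign d blocks) h)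
  columns = proj₂ (∧-elim (isDesign d blocks) h)
  transposed = incidence-transposeᵗ blocks

biplane-example : ∀ {n d} (blocks : Vec (List ℕ) (2 + n)) →
                  Regular′ d (incidence blocks) × IsBiplane (incidence blocks) →
                  Σ (BipGraph (2 + n)) (λ G → Regular d G × DoubleHall G)
biplane-example blocks (regular , biplane) = incidence blocks ,
  Regular′⇒Regular regular , DoubleHall′⇒DoubleHall (s≤s (s≤s z≤n)) (biplane⇒doubleHall biplane)

blocks₂ : Vec (List ℕ) 2
blocks₂ =
  (0 ∷ 1 ∷ [])
  ∷ (0 ∷ 1 ∷ [])
  ∷ []

blocks₃ : Vec (List ℕ) 4
blocks₃ =
  (0 ∷ 2 ∷ 3 ∷ [])
  ∷ (0 ∷ 1 ∷ 3 ∷ [])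
  ∷ (0 ∷ 1 ∷ 2 ∷ [])
  ∷ (1 ∷ 2 ∷ 3 ∷ [])
  ∷ []

blocks₄ : Vec (List ℕ) 7
blocks₄ =
  (0 ∷ 1 ∷ 2 ∷ 4 ∷ [])
  ∷ (1 ∷ 2 ∷ 3 ∷ 5 ∷ [])
  ∷ (2 ∷ 3 ∷ 4 ∷ 6 ∷ [])
  ∷ (0 ∷ 3 ∷ 4 ∷ 5 ∷ [])
  ∷ (1 ∷ 4 ∷ 5 ∷ 6 ∷ [])
  ∷ (0 ∷ 2 ∷ 5 ∷ 6 ∷ [])
  ∷ (0 ∷ 1 ∷ 3 ∷ 6 ∷ [])
  ∷ []

blocks₅ : Vec (List ℕ) 11
blocks₅ =
  (2 ∷ 6 ∷ 7 ∷ 8 ∷ 10 ∷ [])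
  ∷ (0 ∷ 3 ∷ 7 ∷ 8 ∷ 9 ∷ [])
  ∷ (1 ∷ 4 ∷ 8 ∷ 9 ∷ 10 ∷ [])
  ∷ (0 ∷ 2 ∷ 5 ∷ 9 ∷ 10 ∷ [])
  ∷ (0 ∷ 1 ∷ 3 ∷ 6 ∷ 10 ∷ [])
  ∷ (0 ∷ 1 ∷ 2 ∷ 4 ∷ 7 ∷ [])
  ∷ (1 ∷ 2 ∷ 3 ∷ 5 ∷ 8 ∷ [])
  ∷ (2 ∷ 3 ∷ 4 ∷ 6 ∷ 9 ∷ [])
  ∷ (3 ∷ 4 ∷ 5 ∷ 7 ∷ 10 ∷ [])
  ∷ (0 ∷ 4 ∷ 5 ∷ 6 ∷ 8 ∷ [])
  ∷ (1 ∷ 5 ∷ 6 ∷ 7 ∷ 9 ∷ [])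
  ∷ []

blocks₆ : Vec (List ℕ) 16
blocks₆ =
  (0 ∷ 2 ∷ 3 ∷ 6 ∷ 11 ∷ 12 ∷ [])
  ∷ (0 ∷ 1 ∷ 3 ∷ 7 ∷ 8 ∷ 13 ∷ [])
  ∷ (0 ∷ 1 ∷ 2 ∷ 4 ∷ 9 ∷ 14 ∷ [])
  ∷ (1 ∷ 2 ∷ 3 ∷ 5 ∷ 10 ∷ 15 ∷ [])
  ∷ (0 ∷ 4 ∷ 6 ∷ 7 ∷ 10 ∷ 15 ∷ [])
  ∷ (1 ∷ 4 ∷ 5 ∷ 7 ∷ 11 ∷ 12 ∷ [])
  ∷ (2 ∷ 4 ∷ 5 ∷ 6 ∷ 8 ∷ 13 ∷ [])
  ∷ (3 ∷ 5 ∷ 6 ∷ 7 ∷ 9 ∷ 14 ∷ [])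
  ∷ (3 ∷ 4 ∷ 8 ∷ 10 ∷ 11 ∷ 14 ∷ [])
  ∷ (0 ∷ 5 ∷ 8 ∷ 9 ∷ 11 ∷ 15 ∷ [])
  ∷ (1 ∷ 6 ∷ 8 ∷ 9 ∷ 10 ∷ 12 ∷ [])
  ∷ (2 ∷ 7 ∷ 9 ∷ 10 ∷ 11 ∷ 13 ∷ [])
  ∷ (2 ∷ 7 ∷ 8 ∷ 12 ∷ 14 ∷ 15 ∷ [])
  ∷ (3 ∷ 4 ∷ 9 ∷ 12 ∷ 13 ∷ 15 ∷ [])
  ∷ (0 ∷ 5 ∷ 10 ∷ 12 ∷ 13 ∷ 14 ∷ [])
  ∷ (1 ∷ 6 ∷ 11 ∷ 13 ∷ 14 ∷ 15 ∷ [])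
  ∷ []

blocks₉ : Vec (List ℕ) 37
blocks₉ =
  (3 ∷ 4 ∷ 11 ∷ 21 ∷ 25 ∷ 27 ∷ 28 ∷ 30 ∷ 36 ∷ [])
  ∷ (0 ∷ 4 ∷ 5 ∷ 12 ∷ 22 ∷ 26 ∷ 28 ∷ 29 ∷ 31 ∷ [])
  ∷ (1 ∷ 5 ∷ 6 ∷ 13 ∷ 23 ∷ 27 ∷ 29 ∷ 30 ∷ 32 ∷ [])
  ∷ (2 ∷ 6 ∷ 7 ∷ 14 ∷ 24 ∷ 28 ∷ 30 ∷ 31 ∷ 33 ∷ [])
  ∷ (3 ∷ 7 ∷ 8 ∷ 15 ∷ 25 ∷ 29 ∷ 31 ∷ 32 ∷ 34 ∷ [])
  ∷ (4 ∷ 8 ∷ 9 ∷ 16 ∷ 26 ∷ 30 ∷ 32 ∷ 33 ∷ 35 ∷ [])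
  ∷ (5 ∷ 9 ∷ 10 ∷ 17 ∷ 27 ∷ 31 ∷ 33 ∷ 34 ∷ 36 ∷ [])
  ∷ (0 ∷ 6 ∷ 10 ∷ 11 ∷ 18 ∷ 28 ∷ 32 ∷ 34 ∷ 35 ∷ [])
  ∷ (1 ∷ 7 ∷ 11 ∷ 12 ∷ 19 ∷ 29 ∷ 33 ∷ 35 ∷ 36 ∷ [])
  ∷ (0 ∷ 2 ∷ 8 ∷ 12 ∷ 13 ∷ 20 ∷ 30 ∷ 34 ∷ 36 ∷ [])
  ∷ (0 ∷ 1 ∷ 3 ∷ 9 ∷ 13 ∷ 14 ∷ 21 ∷ 31 ∷ 35 ∷ [])
  ∷ (1 ∷ 2 ∷ 4 ∷ 10 ∷ 14 ∷ 15 ∷ 22 ∷ 32 ∷ 36 ∷ [])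
  ∷ (0 ∷ 2 ∷ 3 ∷ 5 ∷ 11 ∷ 15 ∷ 16 ∷ 23 ∷ 33 ∷ [])
  ∷ (1 ∷ 3 ∷ 4 ∷ 6 ∷ 12 ∷ 16 ∷ 17 ∷ 24 ∷ 34 ∷ [])
  ∷ (2 ∷ 4 ∷ 5 ∷ 7 ∷ 13 ∷ 17 ∷ 18 ∷ 25 ∷ 35 ∷ [])
  ∷ (3 ∷ 5 ∷ 6 ∷ 8 ∷ 14 ∷ 18 ∷ 19 ∷ 26 ∷ 36 ∷ [])
  ∷ (0 ∷ 4 ∷ 6 ∷ 7 ∷ 9 ∷ 15 ∷ 19 ∷ 20 ∷ 27 ∷ [])
  ∷ (1 ∷ 5 ∷ 7 ∷ 8 ∷ 10 ∷ 16 ∷ 20 ∷ 21 ∷ 28 ∷ [])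
  ∷ (2 ∷ 6 ∷ 8 ∷ 9 ∷ 11 ∷ 17 ∷ 21 ∷ 22 ∷ 29 ∷ [])
  ∷ (3 ∷ 7 ∷ 9 ∷ 10 ∷ 12 ∷ 18 ∷ 22 ∷ 23 ∷ 30 ∷ [])
  ∷ (4 ∷ 8 ∷ 10 ∷ 11 ∷ 13 ∷ 19 ∷ 23 ∷ 24 ∷ 31 ∷ [])
  ∷ (5 ∷ 9 ∷ 11 ∷ 12 ∷ 14 ∷ 20 ∷ 24 ∷ 25 ∷ 32 ∷ [])
  ∷ (6 ∷ 10 ∷ 12 ∷ 13 ∷ 15 ∷ 21 ∷ 25 ∷ 26 ∷ 33 ∷ [])
  ∷ (7 ∷ 11 ∷ 13 ∷ 14 ∷ 16 ∷ 22 ∷ 26 ∷ 27 ∷ 34 ∷ [])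
  ∷ (8 ∷ 12 ∷ 14 ∷ 15 ∷ 17 ∷ 23 ∷ 27 ∷ 28 ∷ 35 ∷ [])
  ∷ (9 ∷ 13 ∷ 15 ∷ 16 ∷ 18 ∷ 24 ∷ 28 ∷ 29 ∷ 36 ∷ [])
  ∷ (0 ∷ 10 ∷ 14 ∷ 16 ∷ 17 ∷ 19 ∷ 25 ∷ 29 ∷ 30 ∷ [])
  ∷ (1 ∷ 11 ∷ 15 ∷ 17 ∷ 18 ∷ 20 ∷ 26 ∷ 30 ∷ 31 ∷ [])
  ∷ (2 ∷ 12 ∷ 16 ∷ 18 ∷ 19 ∷ 21 ∷ 27 ∷ 31 ∷ 32 ∷ [])
  ∷ (3 ∷ 13 ∷ 17 ∷ 19 ∷ 20 ∷ 22 ∷ 28 ∷ 32 ∷ 33 ∷ [])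
  ∷ (4 ∷ 14 ∷ 18 ∷ 20 ∷ 21 ∷ 23 ∷ 29 ∷ 33 ∷ 34 ∷ [])
  ∷ (5 ∷ 15 ∷ 19 ∷ 21 ∷ 22 ∷ 24 ∷ 30 ∷ 34 ∷ 35 ∷ [])
  ∷ (6 ∷ 16 ∷ 20 ∷ 22 ∷ 23 ∷ 25 ∷ 31 ∷ 35 ∷ 36 ∷ [])
  ∷ (0 ∷ 7 ∷ 17 ∷ 21 ∷ 23 ∷ 24 ∷ 26 ∷ 32 ∷ 36 ∷ [])
  ∷ (0 ∷ 1 ∷ 8 ∷ 18 ∷ 22 ∷ 24 ∷ 25 ∷ 27 ∷ 33 ∷ [])
  ∷ (1 ∷ 2 ∷ 9 ∷ 19 ∷ 23 ∷ 25 ∷ 26 ∷ 28 ∷ 34 ∷ [])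
  ∷ (2 ∷ 3 ∷ 10 ∷ 20 ∷ 24 ∷ 26 ∷ 27 ∷ 29 ∷ 35 ∷ [])
  ∷ []

blocks₁₁ : Vec (List ℕ) 56
blocks₁₁ =
  (0 ∷ 29 ∷ 30 ∷ 33 ∷ 34 ∷ 37 ∷ 38 ∷ 46 ∷ 48 ∷ 50 ∷ 55 ∷ [])
  ∷ (1 ∷ 28 ∷ 31 ∷ 32 ∷ 35 ∷ 37 ∷ 38 ∷ 43 ∷ 45 ∷ 51 ∷ 54 ∷ [])
  ∷ (2 ∷ 29 ∷ 30 ∷ 32 ∷ 35 ∷ 36 ∷ 39 ∷ 40 ∷ 44 ∷ 49 ∷ 52 ∷ [])
  ∷ (3 ∷ 28 ∷ 31 ∷ 33 ∷ 34 ∷ 36 ∷ 39 ∷ 41 ∷ 42 ∷ 47 ∷ 53 ∷ [])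
  ∷ (4 ∷ 21 ∷ 23 ∷ 25 ∷ 27 ∷ 37 ∷ 39 ∷ 47 ∷ 49 ∷ 50 ∷ 54 ∷ [])
  ∷ (5 ∷ 20 ∷ 22 ∷ 24 ∷ 26 ∷ 37 ∷ 39 ∷ 42 ∷ 44 ∷ 51 ∷ 55 ∷ [])
  ∷ (6 ∷ 20 ∷ 22 ∷ 25 ∷ 27 ∷ 36 ∷ 38 ∷ 40 ∷ 45 ∷ 48 ∷ 53 ∷ [])
  ∷ (7 ∷ 21 ∷ 23 ∷ 24 ∷ 26 ∷ 36 ∷ 38 ∷ 41 ∷ 43 ∷ 46 ∷ 52 ∷ [])
  ∷ (8 ∷ 17 ∷ 19 ∷ 25 ∷ 26 ∷ 33 ∷ 35 ∷ 46 ∷ 49 ∷ 51 ∷ 53 ∷ [])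
  ∷ (9 ∷ 17 ∷ 19 ∷ 24 ∷ 27 ∷ 32 ∷ 34 ∷ 42 ∷ 45 ∷ 50 ∷ 52 ∷ [])
  ∷ (10 ∷ 16 ∷ 18 ∷ 25 ∷ 26 ∷ 32 ∷ 34 ∷ 41 ∷ 44 ∷ 48 ∷ 54 ∷ [])
  ∷ (11 ∷ 16 ∷ 18 ∷ 24 ∷ 27 ∷ 33 ∷ 35 ∷ 40 ∷ 43 ∷ 47 ∷ 55 ∷ [])
  ∷ (12 ∷ 17 ∷ 18 ∷ 21 ∷ 22 ∷ 29 ∷ 31 ∷ 47 ∷ 48 ∷ 51 ∷ 52 ∷ [])
  ∷ (13 ∷ 17 ∷ 18 ∷ 20 ∷ 23 ∷ 28 ∷ 30 ∷ 43 ∷ 44 ∷ 50 ∷ 53 ∷ [])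
  ∷ (14 ∷ 16 ∷ 19 ∷ 20 ∷ 23 ∷ 29 ∷ 31 ∷ 41 ∷ 45 ∷ 49 ∷ 55 ∷ [])
  ∷ (15 ∷ 16 ∷ 19 ∷ 21 ∷ 22 ∷ 28 ∷ 30 ∷ 40 ∷ 42 ∷ 46 ∷ 54 ∷ [])
  ∷ (10 ∷ 11 ∷ 14 ∷ 15 ∷ 16 ∷ 38 ∷ 39 ∷ 50 ∷ 51 ∷ 52 ∷ 53 ∷ [])
  ∷ (8 ∷ 9 ∷ 12 ∷ 13 ∷ 17 ∷ 38 ∷ 39 ∷ 40 ∷ 41 ∷ 54 ∷ 55 ∷ [])
  ∷ (10 ∷ 11 ∷ 12 ∷ 13 ∷ 18 ∷ 36 ∷ 37 ∷ 42 ∷ 45 ∷ 46 ∷ 49 ∷ [])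
  ∷ (8 ∷ 9 ∷ 14 ∷ 15 ∷ 19 ∷ 36 ∷ 37 ∷ 43 ∷ 44 ∷ 47 ∷ 48 ∷ [])
  ∷ (5 ∷ 6 ∷ 13 ∷ 14 ∷ 20 ∷ 34 ∷ 35 ∷ 46 ∷ 47 ∷ 52 ∷ 54 ∷ [])
  ∷ (4 ∷ 7 ∷ 12 ∷ 15 ∷ 21 ∷ 34 ∷ 35 ∷ 44 ∷ 45 ∷ 53 ∷ 55 ∷ [])
  ∷ (5 ∷ 6 ∷ 12 ∷ 15 ∷ 22 ∷ 32 ∷ 33 ∷ 41 ∷ 43 ∷ 49 ∷ 50 ∷ [])
  ∷ (4 ∷ 7 ∷ 13 ∷ 14 ∷ 23 ∷ 32 ∷ 33 ∷ 40 ∷ 42 ∷ 48 ∷ 51 ∷ [])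
  ∷ (5 ∷ 7 ∷ 9 ∷ 11 ∷ 24 ∷ 30 ∷ 31 ∷ 48 ∷ 49 ∷ 53 ∷ 54 ∷ [])
  ∷ (4 ∷ 6 ∷ 8 ∷ 10 ∷ 25 ∷ 30 ∷ 31 ∷ 42 ∷ 43 ∷ 52 ∷ 55 ∷ [])
  ∷ (5 ∷ 7 ∷ 8 ∷ 10 ∷ 26 ∷ 28 ∷ 29 ∷ 40 ∷ 45 ∷ 47 ∷ 50 ∷ [])
  ∷ (4 ∷ 6 ∷ 9 ∷ 11 ∷ 27 ∷ 28 ∷ 29 ∷ 41 ∷ 44 ∷ 46 ∷ 51 ∷ [])
  ∷ (1 ∷ 3 ∷ 13 ∷ 15 ∷ 26 ∷ 27 ∷ 28 ∷ 48 ∷ 49 ∷ 52 ∷ 55 ∷ [])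
  ∷ (0 ∷ 2 ∷ 12 ∷ 14 ∷ 26 ∷ 27 ∷ 29 ∷ 42 ∷ 43 ∷ 53 ∷ 54 ∷ [])
  ∷ (0 ∷ 2 ∷ 13 ∷ 15 ∷ 24 ∷ 25 ∷ 30 ∷ 41 ∷ 45 ∷ 47 ∷ 51 ∷ [])
  ∷ (1 ∷ 3 ∷ 12 ∷ 14 ∷ 24 ∷ 25 ∷ 31 ∷ 40 ∷ 44 ∷ 46 ∷ 50 ∷ [])
  ∷ (1 ∷ 2 ∷ 9 ∷ 10 ∷ 22 ∷ 23 ∷ 32 ∷ 46 ∷ 47 ∷ 53 ∷ 55 ∷ [])
  ∷ (0 ∷ 3 ∷ 8 ∷ 11 ∷ 22 ∷ 23 ∷ 33 ∷ 44 ∷ 45 ∷ 52 ∷ 54 ∷ [])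
  ∷ (0 ∷ 3 ∷ 9 ∷ 10 ∷ 20 ∷ 21 ∷ 34 ∷ 40 ∷ 43 ∷ 49 ∷ 51 ∷ [])
  ∷ (1 ∷ 2 ∷ 8 ∷ 11 ∷ 20 ∷ 21 ∷ 35 ∷ 41 ∷ 42 ∷ 48 ∷ 50 ∷ [])
  ∷ (2 ∷ 3 ∷ 6 ∷ 7 ∷ 18 ∷ 19 ∷ 36 ∷ 50 ∷ 51 ∷ 54 ∷ 55 ∷ [])
  ∷ (0 ∷ 1 ∷ 4 ∷ 5 ∷ 18 ∷ 19 ∷ 37 ∷ 40 ∷ 41 ∷ 52 ∷ 53 ∷ [])
  ∷ (0 ∷ 1 ∷ 6 ∷ 7 ∷ 16 ∷ 17 ∷ 38 ∷ 42 ∷ 44 ∷ 47 ∷ 49 ∷ [])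
  ∷ (2 ∷ 3 ∷ 4 ∷ 5 ∷ 16 ∷ 17 ∷ 39 ∷ 43 ∷ 45 ∷ 46 ∷ 48 ∷ [])
  ∷ (2 ∷ 6 ∷ 11 ∷ 15 ∷ 17 ∷ 23 ∷ 26 ∷ 31 ∷ 34 ∷ 37 ∷ 40 ∷ [])
  ∷ (3 ∷ 7 ∷ 10 ∷ 14 ∷ 17 ∷ 22 ∷ 27 ∷ 30 ∷ 35 ∷ 37 ∷ 41 ∷ [])
  ∷ (3 ∷ 5 ∷ 9 ∷ 15 ∷ 18 ∷ 23 ∷ 25 ∷ 29 ∷ 35 ∷ 38 ∷ 42 ∷ [])
  ∷ (1 ∷ 7 ∷ 11 ∷ 13 ∷ 19 ∷ 22 ∷ 25 ∷ 29 ∷ 34 ∷ 39 ∷ 43 ∷ [])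
  ∷ (2 ∷ 5 ∷ 10 ∷ 13 ∷ 19 ∷ 21 ∷ 27 ∷ 31 ∷ 33 ∷ 38 ∷ 44 ∷ [])
  ∷ (1 ∷ 6 ∷ 9 ∷ 14 ∷ 18 ∷ 21 ∷ 26 ∷ 30 ∷ 33 ∷ 39 ∷ 45 ∷ [])
  ∷ (0 ∷ 7 ∷ 8 ∷ 15 ∷ 18 ∷ 20 ∷ 27 ∷ 31 ∷ 32 ∷ 39 ∷ 46 ∷ [])
  ∷ (3 ∷ 4 ∷ 11 ∷ 12 ∷ 19 ∷ 20 ∷ 26 ∷ 30 ∷ 32 ∷ 38 ∷ 47 ∷ [])
  ∷ (0 ∷ 6 ∷ 10 ∷ 12 ∷ 19 ∷ 23 ∷ 24 ∷ 28 ∷ 35 ∷ 39 ∷ 48 ∷ [])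
  ∷ (2 ∷ 4 ∷ 8 ∷ 14 ∷ 18 ∷ 22 ∷ 24 ∷ 28 ∷ 34 ∷ 38 ∷ 49 ∷ [])
  ∷ (0 ∷ 4 ∷ 9 ∷ 13 ∷ 16 ∷ 22 ∷ 26 ∷ 31 ∷ 35 ∷ 36 ∷ 50 ∷ [])
  ∷ (1 ∷ 5 ∷ 8 ∷ 12 ∷ 16 ∷ 23 ∷ 27 ∷ 30 ∷ 34 ∷ 36 ∷ 51 ∷ [])
  ∷ (2 ∷ 7 ∷ 9 ∷ 12 ∷ 16 ∷ 20 ∷ 25 ∷ 28 ∷ 33 ∷ 37 ∷ 52 ∷ [])
  ∷ (3 ∷ 6 ∷ 8 ∷ 13 ∷ 16 ∷ 21 ∷ 24 ∷ 29 ∷ 32 ∷ 37 ∷ 53 ∷ [])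
  ∷ (1 ∷ 4 ∷ 10 ∷ 15 ∷ 17 ∷ 20 ∷ 24 ∷ 29 ∷ 33 ∷ 36 ∷ 54 ∷ [])
  ∷ (0 ∷ 5 ∷ 11 ∷ 14 ∷ 17 ∷ 21 ∷ 25 ∷ 28 ∷ 32 ∷ 36 ∷ 55 ∷ [])
  ∷ []

blocks₁₃ : Vec (List ℕ) 79
blocks₁₃ =
  (0 ∷ 1 ∷ 2 ∷ 3 ∷ 4 ∷ 5 ∷ 6 ∷ 7 ∷ 8 ∷ 9 ∷ 10 ∷ 11 ∷ 12 ∷ [])
  ∷ (0 ∷ 1 ∷ 13 ∷ 14 ∷ 15 ∷ 16 ∷ 17 ∷ 18 ∷ 19 ∷ 20 ∷ 21 ∷ 22 ∷ 23 ∷ [])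
  ∷ (0 ∷ 2 ∷ 13 ∷ 32 ∷ 34 ∷ 37 ∷ 43 ∷ 48 ∷ 52 ∷ 63 ∷ 64 ∷ 75 ∷ 78 ∷ [])
  ∷ (0 ∷ 3 ∷ 14 ∷ 24 ∷ 33 ∷ 38 ∷ 44 ∷ 49 ∷ 53 ∷ 64 ∷ 65 ∷ 68 ∷ 76 ∷ [])
  ∷ (0 ∷ 4 ∷ 15 ∷ 25 ∷ 34 ∷ 39 ∷ 45 ∷ 50 ∷ 54 ∷ 65 ∷ 66 ∷ 69 ∷ 77 ∷ [])
  ∷ (0 ∷ 5 ∷ 16 ∷ 24 ∷ 26 ∷ 35 ∷ 40 ∷ 51 ∷ 55 ∷ 66 ∷ 67 ∷ 70 ∷ 78 ∷ [])
  ∷ (0 ∷ 6 ∷ 17 ∷ 25 ∷ 27 ∷ 36 ∷ 41 ∷ 52 ∷ 56 ∷ 57 ∷ 67 ∷ 68 ∷ 71 ∷ [])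
  ∷ (0 ∷ 7 ∷ 18 ∷ 26 ∷ 28 ∷ 37 ∷ 42 ∷ 46 ∷ 53 ∷ 57 ∷ 58 ∷ 69 ∷ 72 ∷ [])
  ∷ (0 ∷ 8 ∷ 19 ∷ 27 ∷ 29 ∷ 38 ∷ 43 ∷ 47 ∷ 54 ∷ 58 ∷ 59 ∷ 70 ∷ 73 ∷ [])
  ∷ (0 ∷ 9 ∷ 20 ∷ 28 ∷ 30 ∷ 39 ∷ 44 ∷ 48 ∷ 55 ∷ 59 ∷ 60 ∷ 71 ∷ 74 ∷ [])
  ∷ (0 ∷ 10 ∷ 21 ∷ 29 ∷ 31 ∷ 40 ∷ 45 ∷ 49 ∷ 56 ∷ 60 ∷ 61 ∷ 72 ∷ 75 ∷ [])
  ∷ (0 ∷ 11 ∷ 22 ∷ 30 ∷ 32 ∷ 35 ∷ 41 ∷ 46 ∷ 50 ∷ 61 ∷ 62 ∷ 73 ∷ 76 ∷ [])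
  ∷ (0 ∷ 12 ∷ 23 ∷ 31 ∷ 33 ∷ 36 ∷ 42 ∷ 47 ∷ 51 ∷ 62 ∷ 63 ∷ 74 ∷ 77 ∷ [])
  ∷ (1 ∷ 2 ∷ 13 ∷ 28 ∷ 30 ∷ 36 ∷ 42 ∷ 49 ∷ 56 ∷ 65 ∷ 66 ∷ 70 ∷ 73 ∷ [])
  ∷ (1 ∷ 3 ∷ 14 ∷ 29 ∷ 31 ∷ 37 ∷ 43 ∷ 46 ∷ 50 ∷ 66 ∷ 67 ∷ 71 ∷ 74 ∷ [])
  ∷ (1 ∷ 4 ∷ 15 ∷ 30 ∷ 32 ∷ 38 ∷ 44 ∷ 47 ∷ 51 ∷ 57 ∷ 67 ∷ 72 ∷ 75 ∷ [])
  ∷ (1 ∷ 5 ∷ 16 ∷ 31 ∷ 33 ∷ 39 ∷ 45 ∷ 48 ∷ 52 ∷ 57 ∷ 58 ∷ 73 ∷ 76 ∷ [])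
  ∷ (1 ∷ 6 ∷ 17 ∷ 32 ∷ 34 ∷ 35 ∷ 40 ∷ 49 ∷ 53 ∷ 58 ∷ 59 ∷ 74 ∷ 77 ∷ [])
  ∷ (1 ∷ 7 ∷ 18 ∷ 24 ∷ 33 ∷ 36 ∷ 41 ∷ 50 ∷ 54 ∷ 59 ∷ 60 ∷ 75 ∷ 78 ∷ [])
  ∷ (1 ∷ 8 ∷ 19 ∷ 25 ∷ 34 ∷ 37 ∷ 42 ∷ 51 ∷ 55 ∷ 60 ∷ 61 ∷ 68 ∷ 76 ∷ [])
  ∷ (1 ∷ 9 ∷ 20 ∷ 24 ∷ 26 ∷ 38 ∷ 43 ∷ 52 ∷ 56 ∷ 61 ∷ 62 ∷ 69 ∷ 77 ∷ [])
  ∷ (1 ∷ 10 ∷ 21 ∷ 25 ∷ 27 ∷ 39 ∷ 44 ∷ 46 ∷ 53 ∷ 62 ∷ 63 ∷ 70 ∷ 78 ∷ [])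
  ∷ (1 ∷ 11 ∷ 22 ∷ 26 ∷ 28 ∷ 40 ∷ 45 ∷ 47 ∷ 54 ∷ 63 ∷ 64 ∷ 68 ∷ 71 ∷ [])
  ∷ (1 ∷ 12 ∷ 23 ∷ 27 ∷ 29 ∷ 35 ∷ 41 ∷ 48 ∷ 55 ∷ 64 ∷ 65 ∷ 69 ∷ 72 ∷ [])
  ∷ (8 ∷ 12 ∷ 13 ∷ 18 ∷ 40 ∷ 44 ∷ 46 ∷ 48 ∷ 54 ∷ 56 ∷ 67 ∷ 76 ∷ 77 ∷ [])
  ∷ (2 ∷ 9 ∷ 14 ∷ 19 ∷ 41 ∷ 45 ∷ 46 ∷ 47 ∷ 49 ∷ 55 ∷ 57 ∷ 77 ∷ 78 ∷ [])
  ∷ (3 ∷ 10 ∷ 15 ∷ 20 ∷ 35 ∷ 42 ∷ 47 ∷ 48 ∷ 50 ∷ 56 ∷ 58 ∷ 68 ∷ 78 ∷ [])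
  ∷ (4 ∷ 11 ∷ 16 ∷ 21 ∷ 36 ∷ 43 ∷ 46 ∷ 48 ∷ 49 ∷ 51 ∷ 59 ∷ 68 ∷ 69 ∷ [])
  ∷ (5 ∷ 12 ∷ 17 ∷ 22 ∷ 37 ∷ 44 ∷ 47 ∷ 49 ∷ 50 ∷ 52 ∷ 60 ∷ 69 ∷ 70 ∷ [])
  ∷ (2 ∷ 6 ∷ 18 ∷ 23 ∷ 38 ∷ 45 ∷ 48 ∷ 50 ∷ 51 ∷ 53 ∷ 61 ∷ 70 ∷ 71 ∷ [])
  ∷ (3 ∷ 7 ∷ 13 ∷ 19 ∷ 35 ∷ 39 ∷ 49 ∷ 51 ∷ 52 ∷ 54 ∷ 62 ∷ 71 ∷ 72 ∷ [])
  ∷ (4 ∷ 8 ∷ 14 ∷ 20 ∷ 36 ∷ 40 ∷ 50 ∷ 52 ∷ 53 ∷ 55 ∷ 63 ∷ 72 ∷ 73 ∷ [])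
  ∷ (5 ∷ 9 ∷ 15 ∷ 21 ∷ 37 ∷ 41 ∷ 51 ∷ 53 ∷ 54 ∷ 56 ∷ 64 ∷ 73 ∷ 74 ∷ [])
  ∷ (6 ∷ 10 ∷ 16 ∷ 22 ∷ 38 ∷ 42 ∷ 46 ∷ 52 ∷ 54 ∷ 55 ∷ 65 ∷ 74 ∷ 75 ∷ [])
  ∷ (7 ∷ 11 ∷ 17 ∷ 23 ∷ 39 ∷ 43 ∷ 47 ∷ 53 ∷ 55 ∷ 56 ∷ 66 ∷ 75 ∷ 76 ∷ [])
  ∷ (9 ∷ 10 ∷ 13 ∷ 17 ∷ 26 ∷ 29 ∷ 50 ∷ 51 ∷ 57 ∷ 59 ∷ 63 ∷ 65 ∷ 76 ∷ [])
  ∷ (10 ∷ 11 ∷ 14 ∷ 18 ∷ 27 ∷ 30 ∷ 51 ∷ 52 ∷ 58 ∷ 60 ∷ 64 ∷ 66 ∷ 77 ∷ [])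
  ∷ (11 ∷ 12 ∷ 15 ∷ 19 ∷ 28 ∷ 31 ∷ 52 ∷ 53 ∷ 59 ∷ 61 ∷ 65 ∷ 67 ∷ 78 ∷ [])
  ∷ (2 ∷ 12 ∷ 16 ∷ 20 ∷ 29 ∷ 32 ∷ 53 ∷ 54 ∷ 57 ∷ 60 ∷ 62 ∷ 66 ∷ 68 ∷ [])
  ∷ (2 ∷ 3 ∷ 17 ∷ 21 ∷ 30 ∷ 33 ∷ 54 ∷ 55 ∷ 58 ∷ 61 ∷ 63 ∷ 67 ∷ 69 ∷ [])
  ∷ (3 ∷ 4 ∷ 18 ∷ 22 ∷ 31 ∷ 34 ∷ 55 ∷ 56 ∷ 57 ∷ 59 ∷ 62 ∷ 64 ∷ 70 ∷ [])
  ∷ (4 ∷ 5 ∷ 19 ∷ 23 ∷ 24 ∷ 32 ∷ 46 ∷ 56 ∷ 58 ∷ 60 ∷ 63 ∷ 65 ∷ 71 ∷ [])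
  ∷ (5 ∷ 6 ∷ 13 ∷ 20 ∷ 25 ∷ 33 ∷ 46 ∷ 47 ∷ 59 ∷ 61 ∷ 64 ∷ 66 ∷ 72 ∷ [])
  ∷ (6 ∷ 7 ∷ 14 ∷ 21 ∷ 26 ∷ 34 ∷ 47 ∷ 48 ∷ 60 ∷ 62 ∷ 65 ∷ 67 ∷ 73 ∷ [])
  ∷ (7 ∷ 8 ∷ 15 ∷ 22 ∷ 24 ∷ 27 ∷ 48 ∷ 49 ∷ 57 ∷ 61 ∷ 63 ∷ 66 ∷ 74 ∷ [])
  ∷ (8 ∷ 9 ∷ 16 ∷ 23 ∷ 25 ∷ 28 ∷ 49 ∷ 50 ∷ 58 ∷ 62 ∷ 64 ∷ 67 ∷ 75 ∷ [])
  ∷ (4 ∷ 12 ∷ 13 ∷ 14 ∷ 26 ∷ 39 ∷ 41 ∷ 58 ∷ 61 ∷ 68 ∷ 70 ∷ 74 ∷ 75 ∷ [])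
  ∷ (2 ∷ 5 ∷ 14 ∷ 15 ∷ 27 ∷ 40 ∷ 42 ∷ 59 ∷ 62 ∷ 69 ∷ 71 ∷ 75 ∷ 76 ∷ [])
  ∷ (3 ∷ 6 ∷ 15 ∷ 16 ∷ 28 ∷ 41 ∷ 43 ∷ 60 ∷ 63 ∷ 70 ∷ 72 ∷ 76 ∷ 77 ∷ [])
  ∷ (4 ∷ 7 ∷ 16 ∷ 17 ∷ 29 ∷ 42 ∷ 44 ∷ 61 ∷ 64 ∷ 71 ∷ 73 ∷ 77 ∷ 78 ∷ [])
  ∷ (5 ∷ 8 ∷ 17 ∷ 18 ∷ 30 ∷ 43 ∷ 45 ∷ 62 ∷ 65 ∷ 68 ∷ 72 ∷ 74 ∷ 78 ∷ [])
  ∷ (6 ∷ 9 ∷ 18 ∷ 19 ∷ 31 ∷ 35 ∷ 44 ∷ 63 ∷ 66 ∷ 68 ∷ 69 ∷ 73 ∷ 75 ∷ [])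
  ∷ (7 ∷ 10 ∷ 19 ∷ 20 ∷ 32 ∷ 36 ∷ 45 ∷ 64 ∷ 67 ∷ 69 ∷ 70 ∷ 74 ∷ 76 ∷ [])
  ∷ (8 ∷ 11 ∷ 20 ∷ 21 ∷ 33 ∷ 35 ∷ 37 ∷ 57 ∷ 65 ∷ 70 ∷ 71 ∷ 75 ∷ 77 ∷ [])
  ∷ (9 ∷ 12 ∷ 21 ∷ 22 ∷ 34 ∷ 36 ∷ 38 ∷ 58 ∷ 66 ∷ 71 ∷ 72 ∷ 76 ∷ 78 ∷ [])
  ∷ (2 ∷ 10 ∷ 22 ∷ 23 ∷ 24 ∷ 37 ∷ 39 ∷ 59 ∷ 67 ∷ 68 ∷ 72 ∷ 73 ∷ 77 ∷ [])
  ∷ (3 ∷ 11 ∷ 13 ∷ 23 ∷ 25 ∷ 38 ∷ 40 ∷ 57 ∷ 60 ∷ 69 ∷ 73 ∷ 74 ∷ 78 ∷ [])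
  ∷ (8 ∷ 10 ∷ 13 ∷ 16 ∷ 24 ∷ 30 ∷ 31 ∷ 34 ∷ 41 ∷ 47 ∷ 53 ∷ 69 ∷ 71 ∷ [])
  ∷ (9 ∷ 11 ∷ 14 ∷ 17 ∷ 24 ∷ 25 ∷ 31 ∷ 32 ∷ 42 ∷ 48 ∷ 54 ∷ 70 ∷ 72 ∷ [])
  ∷ (10 ∷ 12 ∷ 15 ∷ 18 ∷ 25 ∷ 26 ∷ 32 ∷ 33 ∷ 43 ∷ 49 ∷ 55 ∷ 71 ∷ 73 ∷ [])
  ∷ (2 ∷ 11 ∷ 16 ∷ 19 ∷ 26 ∷ 27 ∷ 33 ∷ 34 ∷ 44 ∷ 50 ∷ 56 ∷ 72 ∷ 74 ∷ [])
  ∷ (3 ∷ 12 ∷ 17 ∷ 20 ∷ 24 ∷ 27 ∷ 28 ∷ 34 ∷ 45 ∷ 46 ∷ 51 ∷ 73 ∷ 75 ∷ [])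
  ∷ (2 ∷ 4 ∷ 18 ∷ 21 ∷ 24 ∷ 25 ∷ 28 ∷ 29 ∷ 35 ∷ 47 ∷ 52 ∷ 74 ∷ 76 ∷ [])
  ∷ (3 ∷ 5 ∷ 19 ∷ 22 ∷ 25 ∷ 26 ∷ 29 ∷ 30 ∷ 36 ∷ 48 ∷ 53 ∷ 75 ∷ 77 ∷ [])
  ∷ (4 ∷ 6 ∷ 20 ∷ 23 ∷ 26 ∷ 27 ∷ 30 ∷ 31 ∷ 37 ∷ 49 ∷ 54 ∷ 76 ∷ 78 ∷ [])
  ∷ (5 ∷ 7 ∷ 13 ∷ 21 ∷ 27 ∷ 28 ∷ 31 ∷ 32 ∷ 38 ∷ 50 ∷ 55 ∷ 68 ∷ 77 ∷ [])
  ∷ (6 ∷ 8 ∷ 14 ∷ 22 ∷ 28 ∷ 29 ∷ 32 ∷ 33 ∷ 39 ∷ 51 ∷ 56 ∷ 69 ∷ 78 ∷ [])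
  ∷ (7 ∷ 9 ∷ 15 ∷ 23 ∷ 29 ∷ 30 ∷ 33 ∷ 34 ∷ 40 ∷ 46 ∷ 52 ∷ 68 ∷ 70 ∷ [])
  ∷ (4 ∷ 9 ∷ 13 ∷ 22 ∷ 27 ∷ 33 ∷ 35 ∷ 42 ∷ 43 ∷ 45 ∷ 53 ∷ 60 ∷ 67 ∷ [])
  ∷ (5 ∷ 10 ∷ 14 ∷ 23 ∷ 28 ∷ 34 ∷ 35 ∷ 36 ∷ 43 ∷ 44 ∷ 54 ∷ 57 ∷ 61 ∷ [])
  ∷ (6 ∷ 11 ∷ 13 ∷ 15 ∷ 24 ∷ 29 ∷ 36 ∷ 37 ∷ 44 ∷ 45 ∷ 55 ∷ 58 ∷ 62 ∷ [])
  ∷ (7 ∷ 12 ∷ 14 ∷ 16 ∷ 25 ∷ 30 ∷ 35 ∷ 37 ∷ 38 ∷ 45 ∷ 56 ∷ 59 ∷ 63 ∷ [])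
  ∷ (2 ∷ 8 ∷ 15 ∷ 17 ∷ 26 ∷ 31 ∷ 35 ∷ 36 ∷ 38 ∷ 39 ∷ 46 ∷ 60 ∷ 64 ∷ [])
  ∷ (3 ∷ 9 ∷ 16 ∷ 18 ∷ 27 ∷ 32 ∷ 36 ∷ 37 ∷ 39 ∷ 40 ∷ 47 ∷ 61 ∷ 65 ∷ [])
  ∷ (4 ∷ 10 ∷ 17 ∷ 19 ∷ 28 ∷ 33 ∷ 37 ∷ 38 ∷ 40 ∷ 41 ∷ 48 ∷ 62 ∷ 66 ∷ [])
  ∷ (5 ∷ 11 ∷ 18 ∷ 20 ∷ 29 ∷ 34 ∷ 38 ∷ 39 ∷ 41 ∷ 42 ∷ 49 ∷ 63 ∷ 67 ∷ [])
  ∷ (6 ∷ 12 ∷ 19 ∷ 21 ∷ 24 ∷ 30 ∷ 39 ∷ 40 ∷ 42 ∷ 43 ∷ 50 ∷ 57 ∷ 64 ∷ [])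
  ∷ (2 ∷ 7 ∷ 20 ∷ 22 ∷ 25 ∷ 31 ∷ 40 ∷ 41 ∷ 43 ∷ 44 ∷ 51 ∷ 58 ∷ 65 ∷ [])
  ∷ (3 ∷ 8 ∷ 21 ∷ 23 ∷ 26 ∷ 32 ∷ 41 ∷ 42 ∷ 44 ∷ 45 ∷ 52 ∷ 59 ∷ 66 ∷ [])
  ∷ []

biplane₁₃ : Regular′ 13 (incidence blocks₁₃) × IsBiplane (incidence blocks₁₃)
biplane₁₃ = biplaneTable-sound blocks₁₃ tt

small-examples : (d : ℕ) → d ∈ (2 ∷ 3 ∷ 4 ∷ 5 ∷ 6 ∷ 9 ∷ 11 ∷ 13 ∷ []) →
                 Σ (BipGraph (d C 2 + 1)) (λ G → Regular d G × DoubleHall G)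
small-examples _ (here refl) = biplane-example blocks₂ (biplaneTable-sound blocks₂ tt)
small-examples _ (there (here refl)) = biplane-example blocks₃ (biplaneTable-sound blocks₃ tt)
small-examples _ (there (there (here refl))) = biplane-example blocks₄ (biplaneTable-sound blocks₄ tt)
small-examples _ (there (there (there (here refl)))) =
  biplane-example blocks₅ (biplaneTable-sound blocks₅ tt)
small-examples _ (there (there (there (there (here refl))))) =
  biplane-example blocks₆ (biplaneTable-sound blocks₆ tt)
small-examples _ (there (there (there (there (there (here refl)))))) =
  biplane-example blocks₉ (biplaneTable-sound blocks₉ tt)
small-examples _ (there (there (there (there (there (there (here refl))))))) =
  biplane-example blocks₁₁ (biplaneTable-sound blocks₁₁ tt)
small-examples _ (there (there (there (there (there (there (there (here refl)))))))) =
  biplane-example blocks₁₃ biplane₁₃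

power : ∀ k → BipGraph (79 ^ suc k)
power zero    = incidence blocks₁₃
power (suc k) = incidence blocks₁₃ ⊗ power k

power-regular : ∀ k → Regular′ (13 ^ suc k) (power k)
power-regular zero    = proj₁ biplane₁₃
power-regular (suc k) = ⊗-regular (proj₁ biplane₁₃) (power-regular k)

power-doubleHall : ∀ k → DoubleHall′ (power k)
power-doubleHall zero    = biplane⇒doubleHall (proj₂ biplane₁₃)
power-doubleHall (suc k) =
  ⊗-doubleHall (proj₁ biplane₁₃) z<s (biplane⇒doubleHall (proj₂ biplane₁₃)) (power-doubleHall k)
               λ b → subst (0 <_) (sym (proj₁ (power-regular k) b)) (m^n>0 13 (suc k))

^-^-≤⇔ : ∀ {m} → 1 < m → ∀ k a b → ((m ^ k) ^ a ≤ m ^ b) ⇔ (k * a ≤ b)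
^-^-≤⇔ {m} 1<m k a b = mk⇔
  (λ h → ^-cancelʳ-≤ 1<m (subst (_≤ m ^ b) (^-*-assoc m k a) h))
  (λ h → subst (_≤ m ^ b) (sym (^-*-assoc m k a)) (^-monoʳ-≤ m {{>-nonZero (<-trans z<s 1<m)}} h))

power-isPowAlpha : ∀ k → IsPowAlpha (79 ^ k) (13 ^ k)
power-isPowAlpha k = m^n>0 79 k , m^n>0 13 k , λ a b _ →
  ⇔.trans (^-^-≤⇔ (s≤s (s≤s z≤n)) k a b) (⇔.sym (^-^-≤⇔ (s≤s (s≤s z≤n)) k a b))

theorem1p11 : ((d : ℕ) → d ∈ (2 ∷ 3 ∷ 4 ∷ 5 ∷ 6 ∷ 9 ∷ 11 ∷ 13 ∷ []) →
    Σ (BipGraph (d C 2 + 1)) (λ G → Regular d G × DoubleHall G))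
    ×
    ((m : ℕ) → ∃[ n ] ∃[ d ] (m ≤ n × IsPowAlpha n d ×
    Σ (BipGraph n) (λ G → Regular d G × DoubleHall G)))
theorem1p11 = small-examples , λ m →
  let m<79^1+m = n<m^n (s≤s (s≤s z≤n)) (suc m) in
  79 ^ suc m , 13 ^ suc m , ≤-trans (n≤1+n m) (<⇒≤ m<79^1+m) , power-isPowAlpha (suc m) ,
  power m , Regular′⇒Regular (power-regular m) ,
  DoubleHall′⇒DoubleHall (≤-trans (s≤s (s≤s z≤n)) m<79^1+m) (power-doubleHall m)
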